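{- Let $n\ge 2$, $h\in[m]$ and $D = (h, \dots, h) \in [m]^n$. Then \[ p_*(D) = \Omega\left(\min\left(1, \frac{n^2 h}{m}\right)\right). \]
   Context: Fix $m\in\mathbb N$ and the universe of IDs $[m]=\{1,\dots,m\}$. An ID-generation algorithm $\mathcal A$ is a probability distribution over permutations of $[m]$: an instance draws a permutation and answers its $t$-th request with the $t$-th entry. A demand profile $D=(d_1,\dots,d_n)$ means $n$ instances of $\mathcal A$ with independent randomness, instance $i$ receiving $d_i$ requests one at a time without knowing $d_i$ in advance. A collision occurs if the sets of output IDs are not pairwise disjoint; $p_{\mathcal A}(D)$ is the collision probability and $p_*(D)=\min_{\mathcal A}p_{\mathcal A}(D)$ over all algorithms. $\Omega$ hides an absolute constant independent of $m,n,h$.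
   Formalization: The ID-generation algorithms are taken as probability distributions over permutations of $[m]$ with rational probabilities. -}

module Defs where

open import Data.Nat using (ℕ; zero; suc)
open import Data.Integer using (+_)
open import Data.Rational using (ℚ; 0ℚ; 1ℚ; _+_; _*_; _/_; _≤_)
open import Data.Fin using (Fin; _≟_)
open import Data.Fin.Permutation using (Permutation′; _⟨$⟩ʳ_)
open import Data.List using (List; []; _∷_; map; concatMap; take; allFin; foldr)
open import Data.Bool.ListAction using (all; any)
open import Data.List.Relation.Unary.All using (All)
open import Data.Product using (_×_; _,_; proj₁; proj₂)
open import Data.Bool using (Bool; true; false; not; _∧_; if_then_else_)
open import Relation.Nullary.Decidable using (⌊_⌋)
open import Relation.Binary.PropositionalEquality using (_≡_)

ℕ→ℚ : ℕ → ℚ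
ℕ→ℚ n = + n / 1

-- An ID-generation algorithm on the universe [m] (encoded as Fin m):
-- a finitely supported probability distribution over permutations of [m],
-- given as a list of (weight, permutation) pairs with nonnegative rational
-- weights summing to 1.
record Algorithm (m : ℕ) : Set where
  field
    support   : List (ℚ × Permutation′ m)
    nonneg    : All (λ wp → 0ℚ ≤ proj₁ wp) support
    sumToOne  : foldr (λ wp s → proj₁ wp + s) 0ℚ support ≡ 1ℚ
open Algorithm public

-- IDs output by an instance which drew permutation σ and received d requests:
-- the first d entries σ(0), ..., σ(d-1).
outputs : {m : ℕ} → Permutation′ m → ℕ → List (Fin m)
outputs {m} σ d = map (σ ⟨$⟩ʳ_) (take d (allFin m))

disjointᵇ : {m : ℕ} → List (Fin m) → List (Fin m) → Bool
disjointᵇ xs ys = all (λ x → not (any (λ y → ⌊ x ≟ y ⌋) ys)) xs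

pairwiseDisjointᵇ : {m : ℕ} → List (List (Fin m)) → Bool
pairwiseDisjointᵇ []         = true
pairwiseDisjointᵇ (xs ∷ xss) = all (disjointᵇ xs) xss ∧ pairwiseDisjointᵇ xss

-- All joint outcomes of independent instances, one per entry of the demand
-- profile, with their probabilities and the output ID-sets of each instance.
runs : {m : ℕ} → List (ℚ × Permutation′ m) → List ℕ → List (ℚ × List (List (Fin m)))
runs A []      = (1ℚ , []) ∷ []
runs A (d ∷ D) =
  concatMap (λ wσ → map (λ r → (proj₁ wσ * proj₁ r , outputs (proj₂ wσ) d ∷ proj₂ r)) (runs A D)) A

collisionProb : {m : ℕ} → Algorithm m → List ℕ → ℚ
collisionProb A D =
  foldr (λ r s → (if pairwiseDisjointᵇ (proj₂ r) then 0ℚ else proj₁ r) + s) 0ℚ (runs (support A) D)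

{-# OPTIONS --safe #-}

-- Give the IDs weights d ≥ 0 such that the h IDs issued by one instance weigh at most 1
-- in total, and let Φ U = ∑_{x ∈ U} P(x is issued) d x for a set U of used IDs.  A fresh
-- instance avoids U with probability at most 1 - Φ U, and Φ is additive on disjoint
-- sets; expanding the resulting product to second order (a Bonferroni bound) shows that
-- j + t instances, j ≤ t, collide with probability at least ½ j² α, where α is the
-- expected Φ-weight of one instance's IDs, as long as j² α ≤ ½ and j Φ(issued σ) ≤ ½
-- for all σ.  Taking j largest with j² α ≤ ¼ gives a collision probability of at least
-- 1/32 or ½ N² α, N = ⌊n/2⌋.  If every ID is issued with probability at most 1/(2N), the
-- weights d = 1/h meet the side condition and give α ≥ h/m by Cauchy–Schwarz; otherwise
-- some ID x₀ is issued more often, and d = δ x₀ forces a collision probability ≥ 1/32.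

module Submission where

open import Defs
open import Data.Nat using (ℕ; _≤_)
open import Data.Rational using (ℚ; 0ℚ; _<_; _*_; _⊓_) renaming (_≤_ to _≤ℚ_)
open import Data.List using (replicate)
open import Data.Product using (Σ; _×_)

open import Algebra.Definitions.RawSemiring Data.Rational.+-*-rawSemiring using (_^_)
open import Data.Bool using (Bool; true; false; not; _∧_; _∨_; if_then_else_)
open import Data.Bool.ListAction using (all; any)
import Data.Bool.Properties
open import Data.Bool.Solver using (module ∨-∧-Solver)
open import Algebra.Lattice.Properties.BooleanAlgebra Data.Bool.Properties.∨-∧-booleanAlgebra using (deMorgan₂)
open import Data.Fin using (Fin; _≟_; zero; suc)
import Data.Fin as Fin
import Data.Fin.Properties
open import Data.Fin.Permutation using (Permutation′; _⟨$⟩ʳ_; _⟨$⟩ˡ_; inverseˡ)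
import Data.Integer as ℤ
import Data.Integer.Properties as ℤP
open import Data.List using (List; []; _∷_; _++_; map; concatMap; take; allFin; foldr; length)
import Data.List.Properties as LP
open import Data.List.Relation.Unary.All using (All; []; _∷_)
import Data.List.Relation.Unary.AllPairs as AllPairs
open import Data.List.Relation.Unary.Unique.Propositional using (Unique)
import Data.List.Relation.Unary.Unique.Propositional.Properties as Uniqueₚ
import Data.Nat as ℕ
open import Data.Nat using (zero; suc; s≤s; z≤n; ⌊_/2⌋; ⌈_/2⌉)
import Data.Nat.Coprimality as Coprimality
import Data.Nat.Properties as ℕP
open import Data.Product using (_,_; proj₁; proj₂; ∃-syntax)
import Data.Rational
open import Data.Rational using (mkℚ; _+_; _-_; -_; _/_; 1/_; 1ℚ; ½)
import Data.Rational.Properties as ℚP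
open import Data.Rational.Properties using (≤-refl; ≤-trans; ≤-reflexive)
open import Data.Sum using (_⊎_; inj₁; inj₂)
import Data.Sum as Sum
open import Function using (_∘_; id)
open import Level using (0ℓ)
open import Relation.Binary.PropositionalEquality
  using (_≡_; _≢_; refl; cong; cong₂; trans; subst; subst₂; module ≡-Reasoning)
  renaming (sym to ≡-sym)
open import Relation.Nullary.Decidable using (⌊_⌋; yes; no; dec⇒maybe)
open import Relation.Nullary.Negation using (¬_; contradiction)
open import Relation.Unary using (Decidable)
import Tactic.RingSolver.Core.AlmostCommutativeRing as ACR
open import Tactic.RingSolver using (solve-∀)

open ∨-∧-Solver using (solve; _:*_; _:=_)

ℚ-ring : ACR.AlmostCommutativeRing 0ℓ 0ℓ
ℚ-ring = ACR.fromCommutativeRing ℚP.+-*-commutativeRing (λ p → dec⇒maybe (0ℚ ℚP.≟ p))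

p≤q⇒0≤q-p : ∀ {p q} → p ≤ℚ q → 0ℚ ≤ℚ q - p
p≤q⇒0≤q-p {p} {q} p≤q = subst (_≤ℚ q - p) (ℚP.+-inverseʳ p) (ℚP.+-monoˡ-≤ (- p) p≤q)

≤-byGap : ∀ {p q} g → q - p ≡ g → 0ℚ ≤ℚ g → p ≤ℚ q
≤-byGap {p} {q} g gap 0≤g =
  subst₂ _≤ℚ_ (ℚP.+-identityʳ p) (p+[q-p]≡q p q) (ℚP.+-monoʳ-≤ p (subst (0ℚ ≤ℚ_) (≡-sym gap) 0≤g))
  where
  p+[q-p]≡q : ∀ p q → p + (q - p) ≡ q
  p+[q-p]≡q = solve-∀ ℚ-ring

*-monoˡ-≤-0≤ : ∀ {r p q} → 0ℚ ≤ℚ r → p ≤ℚ q → r * p ≤ℚ r * q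
*-monoˡ-≤-0≤ {r} 0≤r = ℚP.*-monoˡ-≤-nonNeg r {{Data.Rational.nonNegative 0≤r}}

*-monoʳ-≤-0≤ : ∀ {r p q} → 0ℚ ≤ℚ r → p ≤ℚ q → p * r ≤ℚ q * r
*-monoʳ-≤-0≤ {r} 0≤r = ℚP.*-monoʳ-≤-nonNeg r {{Data.Rational.nonNegative 0≤r}}

*-nonNeg : ∀ {p q} → 0ℚ ≤ℚ p → 0ℚ ≤ℚ q → 0ℚ ≤ℚ p * q
*-nonNeg {p} {q} 0≤p 0≤q = subst (_≤ℚ p * q) (ℚP.*-zeroʳ p) (*-monoˡ-≤-0≤ 0≤p 0≤q)

sub-antimonoʳ-≤ : ∀ {p q} r → p ≤ℚ q → r - q ≤ℚ r - p
sub-antimonoʳ-≤ r p≤q = ℚP.+-monoʳ-≤ r (ℚP.neg-antimono-≤ p≤q)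

p+q≤r⇒p≤r-q : ∀ {p q r} → p + q ≤ℚ r → p ≤ℚ r - q
p+q≤r⇒p≤r-q {p} {q} {r} p+q≤r = ≤-byGap (r - (p + q)) (gap p q r) (p≤q⇒0≤q-p p+q≤r)
  where
  gap : ∀ p q r → r - q - p ≡ r - (p + q)
  gap = solve-∀ ℚ-ring

square-nonNeg : ∀ p → 0ℚ ≤ℚ p * p
square-nonNeg p with ℚP.≤-total 0ℚ p
... | inj₁ 0≤p = *-nonNeg 0≤p 0≤p
... | inj₂ p≤0 = subst (0ℚ ≤ℚ_) (-p*-p≡p*p p) (*-nonNeg 0≤-p 0≤-p)
  where
  0≤-p : 0ℚ ≤ℚ - p
  0≤-p = ℚP.neg-antimono-≤ p≤0
  -p*-p≡p*p : ∀ p → - p * - p ≡ p * p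
  -p*-p≡p*p = solve-∀ ℚ-ring

[1+x]*y≡y+x*y : ∀ x y → (1ℚ + x) * y ≡ y + x * y
[1+x]*y≡y+x*y = solve-∀ ℚ-ring

0≤½ : 0ℚ ≤ℚ ½
0≤½ = ℚP.≤ᵇ⇒≤ _

0≤1 : 0ℚ ≤ℚ 1ℚ
0≤1 = ℚP.≤ᵇ⇒≤ _

¼ : ℚ
¼ = ℤ.+ 1 / 4

½<p⇒¼<p*p : ∀ {p} → ½ < p → ¼ < p * p
½<p⇒¼<p*p {p} ½<p = begin-strict
  ¼          ≡⟨ refl ⟩
  ½ * ½      <⟨ ℚP.*-monoˡ-<-pos ½ ½<p ⟩
  p * ½      <⟨ ℚP.*-monoʳ-<-pos p {{Data.Rational.positive (ℚP.<-trans (ℚP.positive⁻¹ ½) ½<p)}} ½<p ⟩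
  p * p      ∎
  where open ℚP.≤-Reasoning

p*p≤¼⇒p≤½ : ∀ {p} → p * p ≤ℚ ¼ → p ≤ℚ ½
p*p≤¼⇒p≤½ p*p≤¼ = ℚP.≮⇒≥ (λ ½<p → ℚP.<-irrefl refl (ℚP.<-≤-trans (½<p⇒¼<p*p ½<p) p*p≤¼))

1/32 : ℚ
1/32 = ℤ.+ 1 / 32

-- (1 + ι)² ≤ 4 ι² once ι ≥ 1.
1/32≤½ι²a : ∀ {ι a} → 1ℚ ≤ℚ ι → 0ℚ ≤ℚ a → ¼ ≤ℚ (1ℚ + ι) * (1ℚ + ι) * a → 1/32 ≤ℚ ½ * (ι * ι * a)
1/32≤½ι²a {ι} {a} 1≤ι 0≤a ¼≤[1+ι]²a =
  ≤-byGap (⅛ * (a * ((ι + ι + ι + 1ℚ) * (ι - 1ℚ)) + ((1ℚ + ι) * (1ℚ + ι) * a - ¼))) (gap ι a)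
    (*-nonNeg {⅛} (ℚP.≤ᵇ⇒≤ _)
      (ℚP.+-mono-≤ (*-nonNeg 0≤a (*-nonNeg 0≤3ι+1 (p≤q⇒0≤q-p 1≤ι))) (p≤q⇒0≤q-p ¼≤[1+ι]²a)))
  where
  ⅛ = ℤ.+ 1 / 8
  0≤3ι+1 : 0ℚ ≤ℚ ι + ι + ι + 1ℚ
  0≤3ι+1 = ℚP.+-mono-≤ (ℚP.+-mono-≤ (ℚP.+-mono-≤ 0≤ι 0≤ι) 0≤ι) 0≤1
    where
    0≤ι : 0ℚ ≤ℚ ι
    0≤ι = ≤-trans 0≤1 1≤ι
  gap : ∀ ι a → ½ * (ι * ι * a) - 1/32
              ≡ ⅛ * (a * ((ι + ι + ι + 1ℚ) * (ι - 1ℚ)) + ((1ℚ + ι) * (1ℚ + ι) * a - ¼))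
  gap = solve-∀ ℚ-ring

ℕ→ℚ-nonNeg : ∀ n → 0ℚ ≤ℚ ℕ→ℚ n
ℕ→ℚ-nonNeg n = ℚP.nonNegative⁻¹ (ℕ→ℚ n) {{ℚP.normalize-nonNeg n 1}}

ℕ→ℚ-suc : ∀ n → ℕ→ℚ (suc n) ≡ 1ℚ + ℕ→ℚ n
ℕ→ℚ-suc n = ≡-sym (begin
  1ℚ + ℕ→ℚ n                          ≡⟨ cong (1ℚ +_) (ℚP.normalize-coprime coprime) ⟩
  1ℚ + mkℚ (ℤ.+ n) 0 coprime                     ≡⟨⟩
  (ℤ.+ 1 ℤ.* ℤ.+ 1 ℤ.+ ℤ.+ n ℤ.* ℤ.+ 1) / 1     ≡⟨ cong (λ k → (ℤ.+ 1 ℤ.+ k) / 1) (ℤP.*-identityʳ (ℤ.+ n)) ⟩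
  ℕ→ℚ (suc n)                         ∎)
  where
  open ≡-Reasoning
  coprime = Coprimality.sym (Coprimality.1-coprimeTo n)

ℕ→ℚ-+ : ∀ a b → ℕ→ℚ (a ℕ.+ b) ≡ ℕ→ℚ a + ℕ→ℚ b
ℕ→ℚ-+ zero    b = ≡-sym (ℚP.+-identityˡ (ℕ→ℚ b))
ℕ→ℚ-+ (suc a) b = begin
  ℕ→ℚ (suc (a ℕ.+ b))          ≡⟨ ℕ→ℚ-suc (a ℕ.+ b) ⟩
  1ℚ + ℕ→ℚ (a ℕ.+ b)           ≡⟨ cong (1ℚ +_) (ℕ→ℚ-+ a b) ⟩
  1ℚ + (ℕ→ℚ a + ℕ→ℚ b)         ≡⟨ ℚP.+-assoc 1ℚ (ℕ→ℚ a) (ℕ→ℚ b) ⟨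
  1ℚ + ℕ→ℚ a + ℕ→ℚ b           ≡⟨ cong (_+ ℕ→ℚ b) (ℕ→ℚ-suc a) ⟨
  ℕ→ℚ (suc a) + ℕ→ℚ b          ∎
  where open ≡-Reasoning

ℕ→ℚ-* : ∀ a b → ℕ→ℚ (a ℕ.* b) ≡ ℕ→ℚ a * ℕ→ℚ b
ℕ→ℚ-* zero    b = ≡-sym (ℚP.*-zeroˡ (ℕ→ℚ b))
ℕ→ℚ-* (suc a) b = begin
  ℕ→ℚ (b ℕ.+ a ℕ.* b)          ≡⟨ ℕ→ℚ-+ b (a ℕ.* b) ⟩
  ℕ→ℚ b + ℕ→ℚ (a ℕ.* b)        ≡⟨ cong (ℕ→ℚ b +_) (ℕ→ℚ-* a b) ⟩
  ℕ→ℚ b + ℕ→ℚ a * ℕ→ℚ b        ≡⟨ [1+x]*y≡y+x*y (ℕ→ℚ a) (ℕ→ℚ b) ⟨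
  (1ℚ + ℕ→ℚ a) * ℕ→ℚ b         ≡⟨ cong (_* ℕ→ℚ b) (ℕ→ℚ-suc a) ⟨
  ℕ→ℚ (suc a) * ℕ→ℚ b          ∎
  where open ≡-Reasoning

ℕ→ℚ-mono-≤ : ∀ {a b} → a ≤ b → ℕ→ℚ a ≤ℚ ℕ→ℚ b
ℕ→ℚ-mono-≤ {a} {b} a≤b = ≤-byGap (ℕ→ℚ (b ℕ.∸ a)) gap (ℕ→ℚ-nonNeg (b ℕ.∸ a))
  where
  gap : ℕ→ℚ b - ℕ→ℚ a ≡ ℕ→ℚ (b ℕ.∸ a)
  gap = begin
    ℕ→ℚ b - ℕ→ℚ a                          ≡⟨ cong (λ k → ℕ→ℚ k - ℕ→ℚ a) (ℕP.m+[n∸m]≡n a≤b) ⟨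
    ℕ→ℚ (a ℕ.+ (b ℕ.∸ a)) - ℕ→ℚ a          ≡⟨ cong (_- ℕ→ℚ a) (ℕ→ℚ-+ a (b ℕ.∸ a)) ⟩
    ℕ→ℚ a + ℕ→ℚ (b ℕ.∸ a) - ℕ→ℚ a          ≡⟨ x+y-x≡y (ℕ→ℚ a) (ℕ→ℚ (b ℕ.∸ a)) ⟩
    ℕ→ℚ (b ℕ.∸ a)                          ∎
    where
    open ≡-Reasoning
    x+y-x≡y : ∀ x y → x + y - x ≡ y
    x+y-x≡y = solve-∀ ℚ-ring

ℕ→ℚ-reciprocal : ∀ {h} → 1 ≤ h → Σ ℚ (λ v → 0ℚ ≤ℚ v × v * ℕ→ℚ h ≡ 1ℚ)
ℕ→ℚ-reciprocal {h} 1≤h = 1/ ℕ→ℚ h , 0≤1/h , ℚP.*-inverseˡ (ℕ→ℚ h)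
  where
  instance
    h-pos : Data.Rational.Positive (ℕ→ℚ h)
    h-pos = Data.Rational.positive (ℚP.<-≤-trans (ℚP.positive⁻¹ 1ℚ) (ℕ→ℚ-mono-≤ 1≤h))
    h-nonZero : Data.Rational.NonZero (ℕ→ℚ h)
    h-nonZero = ℚP.pos⇒nonZero (ℕ→ℚ h)
  0≤1/h : 0ℚ ≤ℚ 1/ ℕ→ℚ h
  0≤1/h = ℚP.<⇒≤ (ℚP.positive⁻¹ (1/ ℕ→ℚ h) {{ℚP.1/pos⇒pos (ℕ→ℚ h)}})

^-nonNeg : ∀ {p} n → 0ℚ ≤ℚ p → 0ℚ ≤ℚ p ^ n
^-nonNeg zero    0≤p = 0≤1
^-nonNeg (suc n) 0≤p = *-nonNeg 0≤p (^-nonNeg n 0≤p)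

^-monoˡ-≤ : ∀ {p q} n → 0ℚ ≤ℚ p → p ≤ℚ q → p ^ n ≤ℚ q ^ n
^-monoˡ-≤ zero    0≤p p≤q = ≤-refl
^-monoˡ-≤ (suc n) 0≤p p≤q =
  ≤-trans (*-monoˡ-≤-0≤ 0≤p (^-monoˡ-≤ n 0≤p p≤q)) (*-monoʳ-≤-0≤ (^-nonNeg n (≤-trans 0≤p p≤q)) p≤q)

^-≤1 : ∀ {p} n → 0ℚ ≤ℚ p → p ≤ℚ 1ℚ → p ^ n ≤ℚ 1ℚ
^-≤1 zero    0≤p p≤1 = ≤-refl
^-≤1 {p} (suc n) 0≤p p≤1 =
  ≤-trans (*-monoˡ-≤-0≤ 0≤p (^-≤1 n 0≤p p≤1)) (subst (_≤ℚ 1ℚ) (≡-sym (ℚP.*-identityʳ p)) p≤1)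

^-antimonoʳ-≤ : ∀ {p k n} → 0ℚ ≤ℚ p → p ≤ℚ 1ℚ → k ≤ n → p ^ n ≤ℚ p ^ k
^-antimonoʳ-≤ {n = n} 0≤p p≤1 z≤n       = ^-≤1 n 0≤p p≤1
^-antimonoʳ-≤         0≤p p≤1 (s≤s k≤n) = *-monoˡ-≤-0≤ 0≤p (^-antimonoʳ-≤ 0≤p p≤1 k≤n)

[1-s]^n≤1-ns+½n²s² : ∀ n {s} → 0ℚ ≤ℚ s → s ≤ℚ 1ℚ →
                     (1ℚ - s) ^ n ≤ℚ 1ℚ - ℕ→ℚ n * s + ½ * (ℕ→ℚ n * ℕ→ℚ n) * (s * s)
[1-s]^n≤1-ns+½n²s² zero    {s} 0≤s s≤1 = ≤-reflexive (base s)
  where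
  base : ∀ s → 1ℚ ≡ 1ℚ - 0ℚ * s + ½ * (0ℚ * 0ℚ) * (s * s)
  base = solve-∀ ℚ-ring
[1-s]^n≤1-ns+½n²s² (suc n) {s} 0≤s s≤1 = begin
  (1ℚ - s) * (1ℚ - s) ^ n                       ≤⟨ *-monoˡ-≤-0≤ (p≤q⇒0≤q-p s≤1) ([1-s]^n≤1-ns+½n²s² n 0≤s s≤1) ⟩
  (1ℚ - s) * (1ℚ - ν * s + ½ * (ν * ν) * (s * s))  ≤⟨ ≤-byGap _ (step ν s) (ℚP.+-mono-≤ (*-nonNeg 0≤½ (square-nonNeg s))
                                                      (*-nonNeg (*-nonNeg 0≤½ (square-nonNeg ν)) (*-nonNeg 0≤s (square-nonNeg s)))) ⟩
  1ℚ - (1ℚ + ν) * s + ½ * ((1ℚ + ν) * (1ℚ + ν)) * (s * s)  ≡⟨ cong (λ μ → 1ℚ - μ * s + ½ * (μ * μ) * (s * s)) (ℕ→ℚ-suc n) ⟨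
  1ℚ - ℕ→ℚ (suc n) * s + ½ * (ℕ→ℚ (suc n) * ℕ→ℚ (suc n)) * (s * s)  ∎
  where
  open ℚP.≤-Reasoning
  ν = ℕ→ℚ n
  step : ∀ ν s → 1ℚ - (1ℚ + ν) * s + ½ * ((1ℚ + ν) * (1ℚ + ν)) * (s * s) - (1ℚ - s) * (1ℚ - ν * s + ½ * (ν * ν) * (s * s))
                 ≡ ½ * (s * s) + ½ * (ν * ν) * (s * (s * s))
  step = solve-∀ ℚ-ring

crossing : (P : ℕ → Set) → Decidable P → P 0 → ∀ N → P N ⊎ ∃[ j ] (j ℕ.< N × P j × ¬ P (suc j))
crossing P P? P0 zero    = inj₁ P0
crossing P P? P0 (suc N) with P? (suc N) | crossing P P? P0 N
... | yes PN+1 | _                          = inj₁ PN+1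
... | no ¬PN+1 | inj₁ PN                    = inj₂ (N , ℕP.n<1+n N , PN , ¬PN+1)
... | no _     | inj₂ (j , j<N , Pj , ¬Pj+1) = inj₂ (j , ℕP.m<n⇒m<1+n j<N , Pj , ¬Pj+1)

⌊n/2⌋+⌊n/2⌋≤n : ∀ n → ⌊ n /2⌋ ℕ.+ ⌊ n /2⌋ ≤ n
⌊n/2⌋+⌊n/2⌋≤n n = ℕP.≤-trans (ℕP.+-monoʳ-≤ ⌊ n /2⌋ (ℕP.⌊n/2⌋≤⌈n/2⌉ n)) (ℕP.≤-reflexive (ℕP.⌊n/2⌋+⌈n/2⌉≡n n))

n≤3⌊n/2⌋ : ∀ {n} → 2 ≤ n → n ≤ ⌊ n /2⌋ ℕ.+ (⌊ n /2⌋ ℕ.+ ⌊ n /2⌋)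
n≤3⌊n/2⌋ {n} 2≤n = begin
  n                                        ≡⟨ ℕP.⌊n/2⌋+⌈n/2⌉≡n n ⟨
  ⌊ n /2⌋ ℕ.+ ⌈ n /2⌉                       ≤⟨ ℕP.+-monoʳ-≤ ⌊ n /2⌋ (ℕP.⌊n/2⌋-mono (ℕP.n≤1+n (suc n))) ⟩
  ⌊ n /2⌋ ℕ.+ suc ⌊ n /2⌋                   ≤⟨ ℕP.+-monoʳ-≤ ⌊ n /2⌋ (ℕP.+-monoˡ-≤ ⌊ n /2⌋ (ℕP.⌊n/2⌋-mono 2≤n)) ⟩
  ⌊ n /2⌋ ℕ.+ (⌊ n /2⌋ ℕ.+ ⌊ n /2⌋)         ∎
  where open ℕP.≤-Reasoning

-- Finite sums

∑ : {A : Set} → List A → (A → ℚ) → ℚ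
∑ xs f = foldr (λ x s → f x + s) 0ℚ xs

infix 5 ∑
syntax ∑ xs (λ x → e) = ∑[ x ∈ xs ] e

module _ {A : Set} where

  ∑-cong : ∀ (xs : List A) {f g : A → ℚ} → (∀ x → f x ≡ g x) → ∑ xs f ≡ ∑ xs g
  ∑-cong []       f≗g = refl
  ∑-cong (x ∷ xs) f≗g = cong₂ _+_ (f≗g x) (∑-cong xs f≗g)

  ∑-mono-≤ : ∀ (xs : List A) {f g : A → ℚ} → (∀ x → f x ≤ℚ g x) → ∑ xs f ≤ℚ ∑ xs g
  ∑-mono-≤ []       f≤g = ≤-refl
  ∑-mono-≤ (x ∷ xs) f≤g = ℚP.+-mono-≤ (f≤g x) (∑-mono-≤ xs f≤g)

  ∑-zero : ∀ (xs : List A) → ∑[ x ∈ xs ] 0ℚ ≡ 0ℚ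
  ∑-zero []       = refl
  ∑-zero (x ∷ xs) = cong (0ℚ +_) (∑-zero xs)

  ∑-nonNeg : ∀ (xs : List A) {f : A → ℚ} → (∀ x → 0ℚ ≤ℚ f x) → 0ℚ ≤ℚ ∑ xs f
  ∑-nonNeg xs {f} 0≤f = subst (_≤ℚ ∑ xs f) (∑-zero xs) (∑-mono-≤ xs 0≤f)

  ∑-distrib-+ : ∀ (xs : List A) (f g : A → ℚ) → ∑[ x ∈ xs ] (f x + g x) ≡ ∑ xs f + ∑ xs g
  ∑-distrib-+ []       f g = refl
  ∑-distrib-+ (x ∷ xs) f g =
    trans (cong (f x + g x +_) (∑-distrib-+ xs f g)) (interchange (f x) (g x) (∑ xs f) (∑ xs g))
    where
    interchange : ∀ a b c d → a + b + (c + d) ≡ a + c + (b + d)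
    interchange = solve-∀ ℚ-ring

  ∑-distrib-- : ∀ (xs : List A) (f g : A → ℚ) → ∑[ x ∈ xs ] (f x - g x) ≡ ∑ xs f - ∑ xs g
  ∑-distrib-- []       f g = refl
  ∑-distrib-- (x ∷ xs) f g =
    trans (cong (f x - g x +_) (∑-distrib-- xs f g)) (interchange (f x) (g x) (∑ xs f) (∑ xs g))
    where
    interchange : ∀ a b c d → a - b + (c - d) ≡ a + c - (b + d)
    interchange = solve-∀ ℚ-ring

  *-distribˡ-∑ : ∀ c (xs : List A) (f : A → ℚ) → c * ∑ xs f ≡ ∑[ x ∈ xs ] c * f x
  *-distribˡ-∑ c []       f = ℚP.*-zeroʳ c
  *-distribˡ-∑ c (x ∷ xs) f = trans (ℚP.*-distribˡ-+ c (f x) (∑ xs f)) (cong (c * f x +_) (*-distribˡ-∑ c xs f))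

  *-distribʳ-∑ : ∀ c (xs : List A) (f : A → ℚ) → ∑ xs f * c ≡ ∑[ x ∈ xs ] f x * c
  *-distribʳ-∑ c xs f = trans (ℚP.*-comm (∑ xs f) c)
    (trans (*-distribˡ-∑ c xs f) (∑-cong xs (λ x → ℚP.*-comm c (f x))))

  ∑-const : ∀ (xs : List A) c → ∑[ x ∈ xs ] c ≡ ℕ→ℚ (length xs) * c
  ∑-const []       c = ≡-sym (ℚP.*-zeroˡ c)
  ∑-const (x ∷ xs) c = begin
    c + ∑ xs (λ _ → c)                ≡⟨ cong (c +_) (∑-const xs c) ⟩
    c + ℕ→ℚ (length xs) * c           ≡⟨ [1+x]*y≡y+x*y (ℕ→ℚ (length xs)) c ⟨
    (1ℚ + ℕ→ℚ (length xs)) * c        ≡⟨ cong (_* c) (ℕ→ℚ-suc (length xs)) ⟨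
    ℕ→ℚ (length (x ∷ xs)) * c         ∎
    where open ≡-Reasoning

  ∑-++ : ∀ (xs ys : List A) (f : A → ℚ) → ∑ (xs ++ ys) f ≡ ∑ xs f + ∑ ys f
  ∑-++ []       ys f = ≡-sym (ℚP.+-identityˡ (∑ ys f))
  ∑-++ (x ∷ xs) ys f = trans (cong (f x +_) (∑-++ xs ys f)) (≡-sym (ℚP.+-assoc (f x) (∑ xs f) (∑ ys f)))

  ∑-map : ∀ {B : Set} (g : B → A) (ys : List B) (f : A → ℚ) → ∑ (map g ys) f ≡ ∑[ y ∈ ys ] f (g y)
  ∑-map g []       f = refl
  ∑-map g (y ∷ ys) f = cong (f (g y) +_) (∑-map g ys f)

  ∑-concatMap : ∀ {B : Set} (F : B → List A) (ys : List B) (f : A → ℚ) →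
                ∑ (concatMap F ys) f ≡ ∑[ y ∈ ys ] ∑ (F y) f
  ∑-concatMap F []       f = refl
  ∑-concatMap F (y ∷ ys) f = trans (∑-++ (F y) (concatMap F ys) f) (cong (∑ (F y) f +_) (∑-concatMap F ys f))

∑-comm : ∀ {A B : Set} (xs : List A) (ys : List B) (f : A → B → ℚ) →
         ∑[ x ∈ xs ] ∑[ y ∈ ys ] f x y ≡ ∑[ y ∈ ys ] ∑[ x ∈ xs ] f x y
∑-comm []       ys f = ≡-sym (∑-zero ys)
∑-comm (x ∷ xs) ys f = trans (cong (∑ ys (f x) +_) (∑-comm xs ys f))
  (≡-sym (∑-distrib-+ ys (f x) (λ y → ∑[ x ∈ xs ] f x y)))

∑-allFin-suc : ∀ {m} (f : Fin (suc m) → ℚ) → ∑ (allFin (suc m)) f ≡ f zero + (∑[ x ∈ allFin m ] f (suc x))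
∑-allFin-suc {m} f = cong (f zero +_) (trans (cong (λ xs → ∑ xs f) (≡-sym (LP.map-tabulate id Fin.suc))) (∑-map Fin.suc (allFin m) f))

cauchy-schwarz : ∀ {A : Set} (xs : List A) (f : A → ℚ) → ∑ xs f * ∑ xs f ≤ℚ ℕ→ℚ (length xs) * (∑[ x ∈ xs ] f x * f x)
cauchy-schwarz []         f = ≤-refl
cauchy-schwarz xs@(_ ∷ _) f = ≤-byGap _ refl (ℚP.*-cancelˡ-≤-pos M {{M-pos}} (begin
  M * 0ℚ                                     ≡⟨ ℚP.*-zeroʳ M ⟩
  0ℚ                                         ≤⟨ ∑-nonNeg xs (λ x → square-nonNeg (M * f x - Q)) ⟩
  ∑[ x ∈ xs ] (M * f x - Q) * (M * f x - Q)  ≡⟨ ∑-squares ⟩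
  M * (M * R - Q * Q)                        ∎))
  where
  open ℚP.≤-Reasoning
  M = ℕ→ℚ (length xs)
  Q = ∑ xs f
  R = ∑[ x ∈ xs ] f x * f x
  M-pos : Data.Rational.Positive M
  M-pos = Data.Rational.positive (ℚP.<-≤-trans (ℚP.positive⁻¹ 1ℚ) (ℕ→ℚ-mono-≤ {1} {length xs} (s≤s z≤n)))
  expand : ∀ M Q y → (M * y - Q) * (M * y - Q) ≡ M * M * (y * y) + (- (Q + Q) * M) * y + Q * Q
  expand = solve-∀ ℚ-ring
  collect : ∀ M Q R → M * M * R + (- (Q + Q) * M) * Q + M * (Q * Q) ≡ M * (M * R - Q * Q)
  collect = solve-∀ ℚ-ring
  ∑-squares : ∑[ x ∈ xs ] (M * f x - Q) * (M * f x - Q) ≡ M * (M * R - Q * Q)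
  ∑-squares = ≡.begin
    ∑[ x ∈ xs ] (M * f x - Q) * (M * f x - Q)
      ≡.≡⟨ ∑-cong xs (λ x → expand M Q (f x)) ⟩
    ∑[ x ∈ xs ] (M * M * (f x * f x) + (- (Q + Q) * M) * f x + Q * Q)
      ≡.≡⟨ ∑-distrib-+ xs (λ x → M * M * (f x * f x) + (- (Q + Q) * M) * f x) (λ _ → Q * Q) ⟩
    ∑ xs (λ x → M * M * (f x * f x) + (- (Q + Q) * M) * f x) + ∑ xs (λ _ → Q * Q)
      ≡.≡⟨ cong₂ _+_ (∑-distrib-+ xs (λ x → M * M * (f x * f x)) (λ x → (- (Q + Q) * M) * f x)) (∑-const xs (Q * Q)) ⟩
    ∑ xs (λ x → M * M * (f x * f x)) + ∑ xs (λ x → (- (Q + Q) * M) * f x) + M * (Q * Q)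
      ≡.≡⟨ cong (_+ M * (Q * Q)) (cong₂ _+_ (*-distribˡ-∑ (M * M) xs (λ x → f x * f x)) (*-distribˡ-∑ (- (Q + Q) * M) xs f)) ⟨
    M * M * R + (- (Q + Q) * M) * Q + M * (Q * Q)
      ≡.≡⟨ collect M Q R ⟩
    M * (M * R - Q * Q)
      ≡.∎
    where module ≡ = ≡-Reasoning

𝟙 : Bool → ℚ
𝟙 true  = 1ℚ
𝟙 false = 0ℚ

𝟙-nonNeg : ∀ b → 0ℚ ≤ℚ 𝟙 b
𝟙-nonNeg true  = 0≤1
𝟙-nonNeg false = ≤-refl

𝟙-≤1 : ∀ b → 𝟙 b ≤ℚ 1ℚ
𝟙-≤1 true  = ≤-refl
𝟙-≤1 false = 0≤1

𝟙-mono-∨ : ∀ a b → 𝟙 a ≤ℚ 𝟙 (a ∨ b)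
𝟙-mono-∨ true  b = ≤-refl
𝟙-mono-∨ false b = 𝟙-nonNeg b

𝟙-∨ : ∀ a b → a ∧ b ≡ false → 𝟙 (a ∨ b) ≡ 𝟙 a + 𝟙 b
𝟙-∨ true  false _ = refl
𝟙-∨ false b     _ = ≡-sym (ℚP.+-identityˡ (𝟙 b))

if-*ˡ : ∀ b w p → (if b then w * p else 0ℚ) ≡ w * (if b then p else 0ℚ)
if-*ˡ true  w p = refl
if-*ˡ false w p = ≡-sym (ℚP.*-zeroʳ w)

if≤𝟙* : ∀ b {p q} → p ≤ℚ q → (if b then p else 0ℚ) ≤ℚ 𝟙 b * q
if≤𝟙* true  {q = q} p≤q = ≤-trans p≤q (≤-reflexive (≡-sym (ℚP.*-identityˡ q)))
if≤𝟙* false {q = q} _   = ≤-reflexive (≡-sym (ℚP.*-zeroˡ q))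

𝟙*𝟙*-disjoint : ∀ a b p → a ∧ b ≡ false → 𝟙 a * (𝟙 b * p) ≡ 0ℚ
𝟙*𝟙*-disjoint false b     p _ = ℚP.*-zeroˡ (𝟙 b * p)
𝟙*𝟙*-disjoint true  false p _ = trans (ℚP.*-identityˡ (0ℚ * p)) (ℚP.*-zeroˡ p)

⌊suc≟suc⌋ : ∀ {m} (x y : Fin m) → ⌊ suc x ≟ suc y ⌋ ≡ ⌊ x ≟ y ⌋
⌊suc≟suc⌋ x y with x ≟ y
... | yes _ = refl
... | no  _ = refl

∑-δ : ∀ {m} (f : Fin m → ℚ) y → ∑[ x ∈ allFin m ] f x * 𝟙 ⌊ x ≟ y ⌋ ≡ f y
∑-δ {suc m} f zero = begin
  ∑[ x ∈ allFin (suc m) ] f x * 𝟙 ⌊ x ≟ zero ⌋       ≡⟨ ∑-allFin-suc (λ x → f x * 𝟙 ⌊ x ≟ zero ⌋) ⟩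
  f zero * 1ℚ + (∑[ x ∈ allFin m ] f (suc x) * 0ℚ)  ≡⟨ cong (f zero * 1ℚ +_) (∑-cong (allFin m) (λ x → ℚP.*-zeroʳ (f (suc x)))) ⟩
  f zero * 1ℚ + (∑[ x ∈ allFin m ] 0ℚ)              ≡⟨ cong (f zero * 1ℚ +_) (∑-zero (allFin m)) ⟩
  f zero * 1ℚ + 0ℚ                                  ≡⟨ ℚP.+-identityʳ _ ⟩
  f zero * 1ℚ                                       ≡⟨ ℚP.*-identityʳ (f zero) ⟩
  f zero                                            ∎
  where open ≡-Reasoning
∑-δ {suc m} f (suc y) = begin
  ∑[ x ∈ allFin (suc m) ] f x * 𝟙 ⌊ x ≟ suc y ⌋             ≡⟨ ∑-allFin-suc (λ x → f x * 𝟙 ⌊ x ≟ suc y ⌋) ⟩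
  f zero * 0ℚ + (∑[ x ∈ allFin m ] f (suc x) * 𝟙 ⌊ suc x ≟ suc y ⌋)
      ≡⟨ cong (f zero * 0ℚ +_) (∑-cong (allFin m) (λ x → cong (λ b → f (suc x) * 𝟙 b) (⌊suc≟suc⌋ x y))) ⟩
  f zero * 0ℚ + (∑[ x ∈ allFin m ] f (suc x) * 𝟙 ⌊ x ≟ y ⌋)  ≡⟨ cong₂ _+_ (ℚP.*-zeroʳ (f zero)) (∑-δ (f ∘ suc) y) ⟩
  0ℚ + f (suc y)                                            ≡⟨ ℚP.+-identityˡ (f (suc y)) ⟩
  f (suc y)                                                 ∎
  where open ≡-Reasoning

⌊≟⌋-sym : ∀ {m} (x y : Fin m) → ⌊ x ≟ y ⌋ ≡ ⌊ y ≟ x ⌋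
⌊≟⌋-sym x y with x ≟ y | y ≟ x
... | yes _   | yes _   = refl
... | no  _   | no  _   = refl
... | yes x≡y | no  y≢x = contradiction (≡-sym x≡y) y≢x
... | no  x≢y | yes y≡x = contradiction (≡-sym y≡x) x≢y

module _ {m : ℕ} where

  _∈ᵇ_ : Fin m → List (Fin m) → Bool
  x ∈ᵇ ys = any (λ y → ⌊ x ≟ y ⌋) ys

  ∉⇒∈ᵇ≡false : ∀ {x} {ys : List (Fin m)} → All (x ≢_) ys → x ∈ᵇ ys ≡ false
  ∉⇒∈ᵇ≡false {x} []               = refl
  ∉⇒∈ᵇ≡false {x} {y ∷ _} (x≢y ∷ ∉ys) with x ≟ y
  ... | yes x≡y = contradiction x≡y x≢y
  ... | no  _   = ∉⇒∈ᵇ≡false ∉ys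

  ∑-𝟙-∈ᵇ : ∀ (ys : List (Fin m)) → Unique ys → ∑[ x ∈ allFin m ] 𝟙 (x ∈ᵇ ys) ≡ ℕ→ℚ (length ys)
  ∑-𝟙-∈ᵇ []       _           = ∑-zero (allFin m)
  ∑-𝟙-∈ᵇ (y ∷ ys) (y∉ys AllPairs.∷ !ys) = begin
    ∑[ x ∈ allFin m ] 𝟙 (x ∈ᵇ (y ∷ ys))                            ≡⟨ ∑-cong (allFin m) split ⟩
    ∑[ x ∈ allFin m ] (𝟙 ⌊ x ≟ y ⌋ + 𝟙 (x ∈ᵇ ys))                  ≡⟨ ∑-distrib-+ (allFin m) (λ x → 𝟙 ⌊ x ≟ y ⌋) (λ x → 𝟙 (x ∈ᵇ ys)) ⟩
    ∑ (allFin m) (λ x → 𝟙 ⌊ x ≟ y ⌋) + ∑ (allFin m) (λ x → 𝟙 (x ∈ᵇ ys)) ≡⟨ cong₂ _+_ count-y (∑-𝟙-∈ᵇ ys !ys) ⟩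
    1ℚ + ℕ→ℚ (length ys)                                           ≡⟨ ℕ→ℚ-suc (length ys) ⟨
    ℕ→ℚ (length (y ∷ ys))                                          ∎
    where
    open ≡-Reasoning
    split : ∀ x → 𝟙 (x ∈ᵇ (y ∷ ys)) ≡ 𝟙 ⌊ x ≟ y ⌋ + 𝟙 (x ∈ᵇ ys)
    split x with x ≟ y
    ... | yes refl = 𝟙-∨ true (x ∈ᵇ ys) (∉⇒∈ᵇ≡false y∉ys)
    ... | no  _    = 𝟙-∨ false (x ∈ᵇ ys) refl
    count-y : ∑[ x ∈ allFin m ] 𝟙 ⌊ x ≟ y ⌋ ≡ 1ℚ
    count-y = trans (∑-cong (allFin m) (λ x → ≡-sym (ℚP.*-identityˡ (𝟙 ⌊ x ≟ y ⌋)))) (∑-δ (λ _ → 1ℚ) y)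

  outputs-unique : ∀ (σ : Permutation′ m) d → Unique (outputs σ d)
  outputs-unique σ d = Uniqueₚ.map⁺ σ-injective (Uniqueₚ.take⁺ d (Uniqueₚ.allFin⁺ m))
    where
    σ-injective : ∀ {x y} → σ ⟨$⟩ʳ x ≡ σ ⟨$⟩ʳ y → x ≡ y
    σ-injective {x} {y} σx≡σy = trans (≡-sym (inverseˡ σ)) (trans (cong (σ ⟨$⟩ˡ_) σx≡σy) (inverseˡ σ))

  outputs-length : ∀ (σ : Permutation′ m) {d} → d ≤ m → length (outputs σ d) ≡ d
  outputs-length σ {d} d≤m = begin
    length (map (σ ⟨$⟩ʳ_) (take d (allFin m)))   ≡⟨ LP.length-map (σ ⟨$⟩ʳ_) (take d (allFin m)) ⟩
    length (take d (allFin m))                  ≡⟨ LP.length-take d (allFin m) ⟩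
    d ℕ.⊓ length (allFin m)                     ≡⟨ cong (d ℕ.⊓_) (LP.length-tabulate id) ⟩
    d ℕ.⊓ m                                     ≡⟨ ℕP.m≤n⇒m⊓n≡m d≤m ⟩
    d                                           ∎
    where open ≡-Reasoning

  ∑-𝟙-∈ᵇ-outputs : ∀ (σ : Permutation′ m) {d} → d ≤ m → ∑[ x ∈ allFin m ] 𝟙 (x ∈ᵇ outputs σ d) ≡ ℕ→ℚ d
  ∑-𝟙-∈ᵇ-outputs σ {d} d≤m =
    trans (∑-𝟙-∈ᵇ (outputs σ d) (outputs-unique σ d)) (cong ℕ→ℚ (outputs-length σ d≤m))

-- Sets of used IDs

module _ {A : Set} where

  all-cong : ∀ (xs : List A) {f g : A → Bool} → (∀ x → f x ≡ g x) → all f xs ≡ all g xs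
  all-cong []       f≗g = refl
  all-cong (x ∷ xs) f≗g = cong₂ _∧_ (f≗g x) (all-cong xs f≗g)

  all-true : ∀ (xs : List A) → all (λ _ → true) xs ≡ true
  all-true []       = refl
  all-true (x ∷ xs) = all-true xs

  all-∧ : ∀ (xs : List A) (f g : A → Bool) → all (λ x → f x ∧ g x) xs ≡ all f xs ∧ all g xs
  all-∧ []       f g = refl
  all-∧ (x ∷ xs) f g = trans (cong ((f x ∧ g x) ∧_) (all-∧ xs f g)) (interchange (f x) (g x) (all f xs) (all g xs))
    where
    interchange : ∀ a b c d → (a ∧ b) ∧ (c ∧ d) ≡ (a ∧ c) ∧ (b ∧ d)
    interchange = solve 4 (λ a b c d → (a :* b) :* (c :* d) := (a :* c) :* (b :* d)) refl

  all-not : ∀ (xs : List A) (f : A → Bool) → all (λ x → not (f x)) xs ≡ not (any f xs)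
  all-not []       f = refl
  all-not (x ∷ xs) f = trans (cong (not (f x) ∧_) (all-not xs f)) (≡-sym (deMorgan₂ (f x) (any f xs)))

IDSet : ℕ → Set
IDSet m = Fin m → Bool

module _ {m : ℕ} where

  ∅ : IDSet m
  ∅ _ = false

  _∪_ : IDSet m → List (Fin m) → IDSet m
  (U ∪ S) x = U x ∨ x ∈ᵇ S

  avoids : List (Fin m) → IDSet m → Bool
  avoids S U = all (λ x → not (U x)) S

  avoids-∅ : ∀ S → avoids S ∅ ≡ true
  avoids-∅ = all-true

  avoids-∪ : ∀ T U S → avoids T (U ∪ S) ≡ avoids T U ∧ disjointᵇ T S
  avoids-∪ T U S = trans (all-cong T (λ x → deMorgan₂ (U x) (x ∈ᵇ S))) (all-∧ T (λ x → not (U x)) (λ x → not (x ∈ᵇ S)))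

  avoids⇒∉ : ∀ S U x → avoids S U ≡ true → U x ∧ x ∈ᵇ S ≡ false
  avoids⇒∉ []      U x _ = Data.Bool.Properties.∧-zeroʳ (U x)
  avoids⇒∉ (s ∷ S) U x S∩U≡∅ with U s in Us | x ≟ s
  ... | false | yes refl = cong (_∧ true) Us
  ... | false | no  _    = avoids⇒∉ S U x S∩U≡∅

  disjointᵇ-sym : ∀ S T → disjointᵇ S T ≡ disjointᵇ T S
  disjointᵇ-sym []      T = ≡-sym (all-true T)
  disjointᵇ-sym (s ∷ S) T = begin
    not (s ∈ᵇ T) ∧ disjointᵇ S T                                 ≡⟨ cong (not (s ∈ᵇ T) ∧_) (disjointᵇ-sym S T) ⟩
    not (s ∈ᵇ T) ∧ disjointᵇ T S                                 ≡⟨ cong (_∧ disjointᵇ T S) avoid-s ⟨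
    avoids T (λ t → ⌊ t ≟ s ⌋) ∧ disjointᵇ T S                   ≡⟨ avoids-∪ T (λ t → ⌊ t ≟ s ⌋) S ⟨
    disjointᵇ T (s ∷ S)                                          ∎
    where
    open ≡-Reasoning
    avoid-s : avoids T (λ t → ⌊ t ≟ s ⌋) ≡ not (s ∈ᵇ T)
    avoid-s = trans (all-cong T (λ t → cong not (⌊≟⌋-sym t s))) (all-not T (λ t → ⌊ s ≟ t ⌋))

  freshᵇ : IDSet m → List (List (Fin m)) → Bool
  freshᵇ U Ss = pairwiseDisjointᵇ Ss ∧ all (λ S → avoids S U) Ss

  freshᵇ-∅ : ∀ Ss → freshᵇ ∅ Ss ≡ pairwiseDisjointᵇ Ss
  freshᵇ-∅ Ss = trans (cong (pairwiseDisjointᵇ Ss ∧_) (trans (all-cong Ss avoids-∅) (all-true Ss)))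
                      (Data.Bool.Properties.∧-identityʳ (pairwiseDisjointᵇ Ss))

  freshᵇ-∷ : ∀ U S Ss → freshᵇ U (S ∷ Ss) ≡ avoids S U ∧ freshᵇ (U ∪ S) Ss
  freshᵇ-∷ U S Ss = begin
    (all (disjointᵇ S) Ss ∧ pairwiseDisjointᵇ Ss) ∧ (avoids S U ∧ all (λ T → avoids T U) Ss)
      ≡⟨ rearrange (all (disjointᵇ S) Ss) (pairwiseDisjointᵇ Ss) (avoids S U) (all (λ T → avoids T U) Ss) ⟩
    avoids S U ∧ (pairwiseDisjointᵇ Ss ∧ (all (λ T → avoids T U) Ss ∧ all (disjointᵇ S) Ss))
      ≡⟨ cong (λ b → avoids S U ∧ (pairwiseDisjointᵇ Ss ∧ b)) avoid-U∪S ⟨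
    avoids S U ∧ freshᵇ (U ∪ S) Ss
      ∎
    where
    open ≡-Reasoning
    rearrange : ∀ a b c d → (a ∧ b) ∧ (c ∧ d) ≡ c ∧ (b ∧ (d ∧ a))
    rearrange = solve 4 (λ a b c d → (a :* b) :* (c :* d) := c :* (b :* (d :* a))) refl
    avoid-U∪S : all (λ T → avoids T (U ∪ S)) Ss ≡ all (λ T → avoids T U) Ss ∧ all (disjointᵇ S) Ss
    avoid-U∪S = begin
      all (λ T → avoids T (U ∪ S)) Ss                   ≡⟨ all-cong Ss (λ T → trans (avoids-∪ T U S) (cong (avoids T U ∧_) (disjointᵇ-sym T S))) ⟩
      all (λ T → avoids T U ∧ disjointᵇ S T) Ss         ≡⟨ all-∧ Ss (λ T → avoids T U) (disjointᵇ S) ⟩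
      all (λ T → avoids T U) Ss ∧ all (disjointᵇ S) Ss  ∎

-- Expectation and collision-freeness

module Expectation {m : ℕ} (A : Algorithm m) where

  weighted : (Permutation′ m → ℚ) → ℚ × Permutation′ m → ℚ
  weighted f wσ = proj₁ wσ * f (proj₂ wσ)

  𝔼 : (Permutation′ m → ℚ) → ℚ
  𝔼 f = ∑ (support A) (weighted f)

  𝔼-cong : ∀ {f g} → (∀ σ → f σ ≡ g σ) → 𝔼 f ≡ 𝔼 g
  𝔼-cong f≗g = ∑-cong (support A) (λ wσ → cong (proj₁ wσ *_) (f≗g (proj₂ wσ)))

  𝔼-mono-≤ : ∀ {f g} → (∀ σ → f σ ≤ℚ g σ) → 𝔼 f ≤ℚ 𝔼 g
  𝔼-mono-≤ {f} {g} f≤g = go (support A) (nonneg A)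
    where
    go : ∀ ws → All (λ wσ → 0ℚ ≤ℚ proj₁ wσ) ws → ∑ ws (weighted f) ≤ℚ ∑ ws (weighted g)
    go []              []          = ≤-refl
    go ((w , σ) ∷ ws) (0≤w ∷ 0≤ws) = ℚP.+-mono-≤ (*-monoˡ-≤-0≤ 0≤w (f≤g σ)) (go ws 0≤ws)

  𝔼-const : ∀ c → 𝔼 (λ _ → c) ≡ c
  𝔼-const c = begin
    ∑[ wσ ∈ support A ] proj₁ wσ * c    ≡⟨ *-distribʳ-∑ c (support A) proj₁ ⟨
    ∑ (support A) proj₁ * c             ≡⟨ cong (_* c) (sumToOne A) ⟩
    1ℚ * c                              ≡⟨ ℚP.*-identityˡ c ⟩
    c                                   ∎
    where open ≡-Reasoning

  𝔼-nonNeg : ∀ {f} → (∀ σ → 0ℚ ≤ℚ f σ) → 0ℚ ≤ℚ 𝔼 f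
  𝔼-nonNeg {f} 0≤f = subst (_≤ℚ 𝔼 f) (𝔼-const 0ℚ) (𝔼-mono-≤ 0≤f)

  𝔼-distrib-+ : ∀ f g → 𝔼 (λ σ → f σ + g σ) ≡ 𝔼 f + 𝔼 g
  𝔼-distrib-+ f g = trans (∑-cong (support A) (λ wσ → ℚP.*-distribˡ-+ (proj₁ wσ) (f (proj₂ wσ)) (g (proj₂ wσ))))
                          (∑-distrib-+ (support A) (weighted f) (weighted g))

  𝔼-distrib-- : ∀ f g → 𝔼 (λ σ → f σ - g σ) ≡ 𝔼 f - 𝔼 g
  𝔼-distrib-- f g = trans (∑-cong (support A) (λ wσ → w*[a-b]≡w*a-w*b (proj₁ wσ) (f (proj₂ wσ)) (g (proj₂ wσ))))
                          (∑-distrib-- (support A) (weighted f) (weighted g))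
    where
    w*[a-b]≡w*a-w*b : ∀ w a b → w * (a - b) ≡ w * a - w * b
    w*[a-b]≡w*a-w*b = solve-∀ ℚ-ring

  *-distribˡ-𝔼 : ∀ c f → c * 𝔼 f ≡ 𝔼 (λ σ → c * f σ)
  *-distribˡ-𝔼 c f = trans (*-distribˡ-∑ c (support A) (weighted f))
    (∑-cong (support A) (λ wσ → c*[w*a]≡w*[c*a] c (proj₁ wσ) (f (proj₂ wσ))))
    where
    c*[w*a]≡w*[c*a] : ∀ c w a → c * (w * a) ≡ w * (c * a)
    c*[w*a]≡w*[c*a] = solve-∀ ℚ-ring

  *-distribʳ-𝔼 : ∀ c f → 𝔼 f * c ≡ 𝔼 (λ σ → f σ * c)
  *-distribʳ-𝔼 c f = trans (ℚP.*-comm (𝔼 f) c) (trans (*-distribˡ-𝔼 c f) (𝔼-cong (λ σ → ℚP.*-comm c (f σ))))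

  𝔼-quadratic : ∀ a₀ a₁ a₂ f →
                𝔼 (λ σ → a₀ + a₁ * f σ + a₂ * (f σ * f σ)) ≡ a₀ + a₁ * 𝔼 f + a₂ * 𝔼 (λ σ → f σ * f σ)
  𝔼-quadratic a₀ a₁ a₂ f = begin
    𝔼 (λ σ → a₀ + a₁ * f σ + a₂ * (f σ * f σ))                 ≡⟨ 𝔼-distrib-+ (λ σ → a₀ + a₁ * f σ) (λ σ → a₂ * (f σ * f σ)) ⟩
    𝔼 (λ σ → a₀ + a₁ * f σ) + 𝔼 (λ σ → a₂ * (f σ * f σ))       ≡⟨ cong (_+ _) (𝔼-distrib-+ (λ _ → a₀) (λ σ → a₁ * f σ)) ⟩
    𝔼 (λ _ → a₀) + 𝔼 (λ σ → a₁ * f σ) + 𝔼 (λ σ → a₂ * (f σ * f σ))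
      ≡⟨ cong₂ _+_ (cong₂ _+_ (𝔼-const a₀) (≡-sym (*-distribˡ-𝔼 a₁ f))) (≡-sym (*-distribˡ-𝔼 a₂ (λ σ → f σ * f σ))) ⟩
    a₀ + a₁ * 𝔼 f + a₂ * 𝔼 (λ σ → f σ * f σ)                    ∎
    where open ≡-Reasoning

  ∑-𝔼-comm : ∀ {X : Set} (xs : List X) (F : X → Permutation′ m → ℚ) →
             ∑[ x ∈ xs ] 𝔼 (F x) ≡ 𝔼 (λ σ → ∑[ x ∈ xs ] F x σ)
  ∑-𝔼-comm xs F = trans (∑-comm xs (support A) (λ x → weighted (F x)))
    (∑-cong (support A) (λ wσ → ≡-sym (*-distribˡ-∑ (proj₁ wσ) xs (λ x → F x (proj₂ wσ)))))

  ∑-runs-∷ : ∀ d D (g : ℚ × List (List (Fin m)) → ℚ) →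
             ∑ (runs (support A) (d ∷ D)) g
               ≡ ∑[ wσ ∈ support A ] ∑[ r ∈ runs (support A) D ] g (proj₁ wσ * proj₁ r , outputs (proj₂ wσ) d ∷ proj₂ r)
  ∑-runs-∷ d D g = trans (∑-concatMap _ (support A) g) (∑-cong (support A) (λ wσ → ∑-map _ (runs (support A) D) g))

  ∑-runs-weights : ∀ D → ∑ (runs (support A) D) proj₁ ≡ 1ℚ
  ∑-runs-weights []      = ℚP.+-identityʳ 1ℚ
  ∑-runs-weights (d ∷ D) = begin
    ∑ (runs (support A) (d ∷ D)) proj₁                                ≡⟨ ∑-runs-∷ d D proj₁ ⟩
    ∑[ wσ ∈ support A ] ∑[ r ∈ runs (support A) D ] proj₁ wσ * proj₁ r  ≡⟨ ∑-cong (support A) (λ wσ → *-distribˡ-∑ (proj₁ wσ) (runs (support A) D) proj₁) ⟨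
    𝔼 (λ _ → ∑ (runs (support A) D) proj₁)                            ≡⟨ cong (λ c → 𝔼 (λ _ → c)) (∑-runs-weights D) ⟩
    𝔼 (λ _ → 1ℚ)                                                      ≡⟨ 𝔼-const 1ℚ ⟩
    1ℚ                                                                ∎
    where open ≡-Reasoning

module NoCollision {m : ℕ} (A : Algorithm m) (h : ℕ) where
  open Expectation A

  issued : Permutation′ m → List (Fin m)
  issued σ = outputs σ h

  noCollision : ℕ → IDSet m → ℚ
  noCollision zero    U = 1ℚ
  noCollision (suc r) U = 𝔼 (λ σ → if avoids (issued σ) U then noCollision r (U ∪ issued σ) else 0ℚ)

  collision : ℕ → ℚ
  collision n = 1ℚ - noCollision n ∅

  hitProb : Fin m → ℚ
  hitProb x = 𝔼 (λ σ → 𝟙 (x ∈ᵇ issued σ))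

  hitProb-nonNeg : ∀ x → 0ℚ ≤ℚ hitProb x
  hitProb-nonNeg x = 𝔼-nonNeg (λ σ → 𝟙-nonNeg (x ∈ᵇ issued σ))

  freshWeight : IDSet m → ℚ × List (List (Fin m)) → ℚ
  freshWeight U r = if freshᵇ U (proj₂ r) then proj₁ r else 0ℚ

  ∑-runs-freshWeight : ∀ n U → ∑ (runs (support A) (replicate n h)) (freshWeight U) ≡ noCollision n U
  ∑-runs-freshWeight zero    U = ℚP.+-identityʳ 1ℚ
  ∑-runs-freshWeight (suc n) U = trans (∑-runs-∷ h (replicate n h) (freshWeight U)) (∑-cong (support A) first-instance)
    where
    rs = runs (support A) (replicate n h)
    first-instance : ∀ wσ → ∑[ r ∈ rs ] freshWeight U (proj₁ wσ * proj₁ r , issued (proj₂ wσ) ∷ proj₂ r)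
                            ≡ weighted (λ σ → if avoids (issued σ) U then noCollision n (U ∪ issued σ) else 0ℚ) wσ
    first-instance (w , σ) = begin
      ∑[ r ∈ rs ] freshWeight U (w * proj₁ r , issued σ ∷ proj₂ r)
        ≡⟨ ∑-cong rs (λ r → cong (λ b → if b then w * proj₁ r else 0ℚ) (freshᵇ-∷ U (issued σ) (proj₂ r))) ⟩
      ∑[ r ∈ rs ] (if avoids (issued σ) U ∧ freshᵇ (U ∪ issued σ) (proj₂ r) then w * proj₁ r else 0ℚ)
        ≡⟨ by-avoidance (avoids (issued σ) U) ⟩
      w * (if avoids (issued σ) U then noCollision n (U ∪ issued σ) else 0ℚ)
        ∎
      where
      open ≡-Reasoning
      by-avoidance : ∀ b → ∑[ r ∈ rs ] (if b ∧ freshᵇ (U ∪ issued σ) (proj₂ r) then w * proj₁ r else 0ℚ)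
                           ≡ w * (if b then noCollision n (U ∪ issued σ) else 0ℚ)
      by-avoidance true  = begin
        ∑[ r ∈ rs ] (if freshᵇ (U ∪ issued σ) (proj₂ r) then w * proj₁ r else 0ℚ)
          ≡⟨ ∑-cong rs (λ r → if-*ˡ (freshᵇ (U ∪ issued σ) (proj₂ r)) w (proj₁ r)) ⟩
        ∑[ r ∈ rs ] w * freshWeight (U ∪ issued σ) r
          ≡⟨ *-distribˡ-∑ w rs (freshWeight (U ∪ issued σ)) ⟨
        w * ∑ rs (freshWeight (U ∪ issued σ))
          ≡⟨ cong (w *_) (∑-runs-freshWeight n (U ∪ issued σ)) ⟩
        w * noCollision n (U ∪ issued σ)
          ∎
      by-avoidance false = trans (∑-zero rs) (≡-sym (ℚP.*-zeroʳ w))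

  collisionProb≡collision : ∀ n → collisionProb A (replicate n h) ≡ collision n
  collisionProb≡collision n = begin
    collisionProb A (replicate n h)                      ≡⟨ ∑-cong rs (λ r → if-complement (pairwiseDisjointᵇ (proj₂ r)) (proj₁ r)) ⟩
    ∑[ r ∈ rs ] (proj₁ r - (if pairwiseDisjointᵇ (proj₂ r) then proj₁ r else 0ℚ))
                                                         ≡⟨ ∑-cong rs (λ r → cong (λ b → proj₁ r - (if b then proj₁ r else 0ℚ)) (freshᵇ-∅ (proj₂ r))) ⟨
    ∑[ r ∈ rs ] (proj₁ r - freshWeight ∅ r)              ≡⟨ ∑-distrib-- rs proj₁ (freshWeight ∅) ⟩
    ∑ rs proj₁ - ∑ rs (freshWeight ∅)                    ≡⟨ cong₂ _-_ (∑-runs-weights (replicate n h)) (∑-runs-freshWeight n ∅) ⟩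
    collision n                                          ∎
    where
    open ≡-Reasoning
    rs = runs (support A) (replicate n h)
    if-complement : ∀ b w → (if b then 0ℚ else w) ≡ w - (if b then w else 0ℚ)
    if-complement true  w = ≡-sym (ℚP.+-inverseʳ w)
    if-complement false w = ≡-sym (ℚP.+-identityʳ w)

-- The potential Φ

module Potential {m : ℕ} (A : Algorithm m) (h : ℕ) (d : Fin m → ℚ) (0≤d : ∀ x → 0ℚ ≤ℚ d x)
                 (load≤1 : ∀ σ → ∑[ x ∈ allFin m ] 𝟙 (x ∈ᵇ outputs σ h) * d x ≤ℚ 1ℚ) where
  open Expectation A
  open NoCollision A h

  charge : Fin m → ℚ
  charge x = hitProb x * d x

  Φ : IDSet m → ℚ
  Φ U = ∑[ x ∈ allFin m ] 𝟙 (U x) * charge x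

  φ : Permutation′ m → ℚ
  φ σ = Φ (_∈ᵇ issued σ)

  α β : ℚ
  α = 𝔼 φ
  β = 𝔼 (λ σ → φ σ * φ σ)

  charge-nonNeg : ∀ x → 0ℚ ≤ℚ charge x
  charge-nonNeg x = *-nonNeg (hitProb-nonNeg x) (0≤d x)

  Φ-nonNeg : ∀ U → 0ℚ ≤ℚ Φ U
  Φ-nonNeg U = ∑-nonNeg (allFin m) (λ x → *-nonNeg (𝟙-nonNeg (U x)) (charge-nonNeg x))

  φ-nonNeg : ∀ σ → 0ℚ ≤ℚ φ σ
  φ-nonNeg σ = Φ-nonNeg (_∈ᵇ issued σ)

  α-nonNeg : 0ℚ ≤ℚ α
  α-nonNeg = 𝔼-nonNeg φ-nonNeg

  β-nonNeg : 0ℚ ≤ℚ β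
  β-nonNeg = 𝔼-nonNeg (λ σ → square-nonNeg (φ σ))

  Φ-∅ : Φ ∅ ≡ 0ℚ
  Φ-∅ = trans (∑-cong (allFin m) (λ x → ℚP.*-zeroˡ (charge x))) (∑-zero (allFin m))

  Φ-mono-∪ : ∀ U S → Φ U ≤ℚ Φ (U ∪ S)
  Φ-mono-∪ U S = ∑-mono-≤ (allFin m) (λ x → *-monoʳ-≤-0≤ (charge-nonNeg x) (𝟙-mono-∨ (U x) (x ∈ᵇ S)))

  Φ-∪ : ∀ U σ → avoids (issued σ) U ≡ true → Φ (U ∪ issued σ) ≡ Φ U + φ σ
  Φ-∪ U σ S∩U≡∅ = trans (∑-cong (allFin m) split)
    (∑-distrib-+ (allFin m) (λ x → 𝟙 (U x) * charge x) (λ x → 𝟙 (x ∈ᵇ issued σ) * charge x))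
    where
    split : ∀ x → 𝟙 (U x ∨ x ∈ᵇ issued σ) * charge x ≡ 𝟙 (U x) * charge x + 𝟙 (x ∈ᵇ issued σ) * charge x
    split x = trans (cong (_* charge x) (𝟙-∨ (U x) (x ∈ᵇ issued σ) (avoids⇒∉ (issued σ) U x S∩U≡∅)))
                    (ℚP.*-distribʳ-+ (charge x) (𝟙 (U x)) (𝟙 (x ∈ᵇ issued σ)))

  Φ-as-𝔼 : ∀ U → Φ U ≡ 𝔼 (λ σ → ∑[ x ∈ allFin m ] 𝟙 (U x) * (𝟙 (x ∈ᵇ issued σ) * d x))
  Φ-as-𝔼 U = trans (∑-cong (allFin m) pull-in) (∑-𝔼-comm (allFin m) (λ x σ → 𝟙 (U x) * (𝟙 (x ∈ᵇ issued σ) * d x)))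
    where
    pull-in : ∀ x → 𝟙 (U x) * charge x ≡ 𝔼 (λ σ → 𝟙 (U x) * (𝟙 (x ∈ᵇ issued σ) * d x))
    pull-in x = trans (cong (𝟙 (U x) *_) (*-distribʳ-𝔼 (d x) (λ σ → 𝟙 (x ∈ᵇ issued σ))))
                      (*-distribˡ-𝔼 (𝟙 (U x)) (λ σ → 𝟙 (x ∈ᵇ issued σ) * d x))

  avoidance+shared≤1 : ∀ U σ → 𝟙 (avoids (issued σ) U) + (∑[ x ∈ allFin m ] 𝟙 (U x) * (𝟙 (x ∈ᵇ issued σ) * d x)) ≤ℚ 1ℚ
  avoidance+shared≤1 U σ = by-avoidance (avoids (issued σ) U) refl
    where
    shared = ∑[ x ∈ allFin m ] 𝟙 (U x) * (𝟙 (x ∈ᵇ issued σ) * d x)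
    by-avoidance : ∀ b → avoids (issued σ) U ≡ b → 𝟙 b + shared ≤ℚ 1ℚ
    by-avoidance true S∩U≡∅ = ≤-reflexive (begin
      1ℚ + shared                      ≡⟨ cong (1ℚ +_) (∑-cong (allFin m) no-shared) ⟩
      1ℚ + (∑[ x ∈ allFin m ] 0ℚ)       ≡⟨ cong (1ℚ +_) (∑-zero (allFin m)) ⟩
      1ℚ + 0ℚ                           ≡⟨ ℚP.+-identityʳ 1ℚ ⟩
      1ℚ                                ∎)
      where
      open ≡-Reasoning
      no-shared : ∀ x → 𝟙 (U x) * (𝟙 (x ∈ᵇ issued σ) * d x) ≡ 0ℚ
      no-shared x = 𝟙*𝟙*-disjoint (U x) (x ∈ᵇ issued σ) (d x) (avoids⇒∉ (issued σ) U x S∩U≡∅)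
    by-avoidance false _ = begin
      0ℚ + shared                                           ≡⟨ ℚP.+-identityˡ shared ⟩
      shared                                                ≤⟨ ∑-mono-≤ (allFin m) drop-U ⟩
      ∑[ x ∈ allFin m ] 𝟙 (x ∈ᵇ issued σ) * d x              ≤⟨ load≤1 σ ⟩
      1ℚ                                                     ∎
      where
      open ℚP.≤-Reasoning
      drop-U : ∀ x → 𝟙 (U x) * (𝟙 (x ∈ᵇ issued σ) * d x) ≤ℚ 𝟙 (x ∈ᵇ issued σ) * d x
      drop-U x = ≤-trans (*-monoʳ-≤-0≤ (*-nonNeg (𝟙-nonNeg (x ∈ᵇ issued σ)) (0≤d x)) (𝟙-≤1 (U x)))
                         (≤-reflexive (ℚP.*-identityˡ _))

  avoidance≤1-Φ : ∀ U → 𝔼 (λ σ → 𝟙 (avoids (issued σ) U)) ≤ℚ 1ℚ - Φ U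
  avoidance≤1-Φ U = p+q≤r⇒p≤r-q (begin
    𝔼 (λ σ → 𝟙 (avoids (issued σ) U)) + Φ U              ≡⟨ cong (𝔼 (λ σ → 𝟙 (avoids (issued σ) U)) +_) (Φ-as-𝔼 U) ⟩
    𝔼 (λ σ → 𝟙 (avoids (issued σ) U)) + 𝔼 shared        ≡⟨ 𝔼-distrib-+ (λ σ → 𝟙 (avoids (issued σ) U)) shared ⟨
    𝔼 (λ σ → 𝟙 (avoids (issued σ) U) + shared σ)        ≤⟨ 𝔼-mono-≤ (avoidance+shared≤1 U) ⟩
    𝔼 (λ _ → 1ℚ)                                         ≡⟨ 𝔼-const 1ℚ ⟩
    1ℚ                                                   ∎)
    where
    open ℚP.≤-Reasoning
    shared : Permutation′ m → ℚ
    shared σ = ∑[ x ∈ allFin m ] 𝟙 (U x) * (𝟙 (x ∈ᵇ issued σ) * d x)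

  0≤1-Φ : ∀ U → 0ℚ ≤ℚ 1ℚ - Φ U
  0≤1-Φ U = ≤-trans (𝔼-nonNeg (λ σ → 𝟙-nonNeg (avoids (issued σ) U))) (avoidance≤1-Φ U)

  Φ≤1 : ∀ U → Φ U ≤ℚ 1ℚ
  Φ≤1 U = ≤-byGap _ refl (0≤1-Φ U)

  noCollision≤[1-Φ]^ : ∀ t U → noCollision t U ≤ℚ (1ℚ - Φ U) ^ t
  noCollision≤[1-Φ]^ zero    U = ≤-refl
  noCollision≤[1-Φ]^ (suc t) U = begin
    𝔼 (λ σ → if avoids (issued σ) U then noCollision t (U ∪ issued σ) else 0ℚ)  ≤⟨ 𝔼-mono-≤ (λ σ → if≤𝟙* (avoids (issued σ) U) (grown σ)) ⟩
    𝔼 (λ σ → 𝟙 (avoids (issued σ) U) * (1ℚ - Φ U) ^ t)                          ≡⟨ *-distribʳ-𝔼 ((1ℚ - Φ U) ^ t) _ ⟨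
    𝔼 (λ σ → 𝟙 (avoids (issued σ) U)) * (1ℚ - Φ U) ^ t                          ≤⟨ *-monoʳ-≤-0≤ (^-nonNeg t (0≤1-Φ U)) (avoidance≤1-Φ U) ⟩
    (1ℚ - Φ U) * (1ℚ - Φ U) ^ t                                                 ∎
    where
    open ℚP.≤-Reasoning
    grown : ∀ σ → noCollision t (U ∪ issued σ) ≤ℚ (1ℚ - Φ U) ^ t
    grown σ = ≤-trans (noCollision≤[1-Φ]^ t (U ∪ issued σ))
                      (^-monoˡ-≤ t (0≤1-Φ (U ∪ issued σ)) (sub-antimonoʳ-≤ 1ℚ (Φ-mono-∪ U (issued σ))))

  α≤collision : ∀ t → α ≤ℚ collision (suc (suc t))
  α≤collision t = ≤-byGap _ (gap α (noCollision (suc (suc t)) ∅)) (p≤q⇒0≤q-p (begin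
    noCollision (suc (suc t)) ∅   ≤⟨ 𝔼-mono-≤ first-instance ⟩
    𝔼 (λ σ → 1ℚ - φ σ)            ≡⟨ 𝔼-distrib-- (λ _ → 1ℚ) φ ⟩
    𝔼 (λ _ → 1ℚ) - α              ≡⟨ cong (_- α) (𝔼-const 1ℚ) ⟩
    1ℚ - α                        ∎))
    where
    open ℚP.≤-Reasoning
    gap : ∀ a p → 1ℚ - p - a ≡ 1ℚ - a - p
    gap = solve-∀ ℚ-ring
    first-instance : ∀ σ → (if avoids (issued σ) ∅ then noCollision (suc t) (∅ ∪ issued σ) else 0ℚ) ≤ℚ 1ℚ - φ σ
    first-instance σ rewrite avoids-∅ (issued σ) = begin
      noCollision (suc t) (∅ ∪ issued σ)   ≤⟨ noCollision≤[1-Φ]^ (suc t) (∅ ∪ issued σ) ⟩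
      (1ℚ - φ σ) ^ suc t                   ≤⟨ ^-antimonoʳ-≤ {k = 1} {n = suc t} (0≤1-Φ (∅ ∪ issued σ)) (sub-antimonoʳ-≤ 1ℚ (φ-nonNeg σ)) (s≤s z≤n) ⟩
      (1ℚ - φ σ) ^ 1                       ≡⟨ ℚP.*-identityʳ (1ℚ - φ σ) ⟩
      1ℚ - φ σ                             ∎

  α≡∑hitProb*charge : α ≡ ∑[ x ∈ allFin m ] hitProb x * charge x
  α≡∑hitProb*charge = begin
    𝔼 (λ σ → ∑[ x ∈ allFin m ] 𝟙 (x ∈ᵇ issued σ) * charge x)     ≡⟨ ∑-𝔼-comm (allFin m) (λ x σ → 𝟙 (x ∈ᵇ issued σ) * charge x) ⟨
    ∑[ x ∈ allFin m ] 𝔼 (λ σ → 𝟙 (x ∈ᵇ issued σ) * charge x)     ≡⟨ ∑-cong (allFin m) (λ x → *-distribʳ-𝔼 (charge x) _) ⟨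
    ∑[ x ∈ allFin m ] hitProb x * charge x                       ∎
    where open ≡-Reasoning

  -- R K s bounds 𝔼[1 - τ X + ½ τ² X²] for X = s + φ σ₁ + ⋯ + φ σ_K,
  -- since 𝔼 X = s + K α and 𝔼 X² ≤ (s + K α)² + K β.
  module SecondOrder (T : ℕ) where

    τ : ℚ
    τ = ℕ→ℚ T

    R : ℚ → ℚ → ℚ
    R K s = 1ℚ - τ * (s + K * α) + ½ * (τ * τ) * ((s + K * α) * (s + K * α) + K * β)

    R-nonNeg : ∀ {K} s → 0ℚ ≤ℚ K → 0ℚ ≤ℚ R K s
    R-nonNeg {K} s 0≤K = subst (0ℚ ≤ℚ_) (≡-sym (sum-of-squares τ K s α β))
      (ℚP.+-mono-≤ (ℚP.+-mono-≤ (*-nonNeg 0≤½ (square-nonNeg (1ℚ - τ * (s + K * α)))) 0≤½)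
                   (*-nonNeg (*-nonNeg 0≤½ (square-nonNeg τ)) (*-nonNeg 0≤K β-nonNeg)))
      where
      sum-of-squares : ∀ τ K s α β →
        1ℚ - τ * (s + K * α) + ½ * (τ * τ) * ((s + K * α) * (s + K * α) + K * β)
          ≡ ½ * ((1ℚ - τ * (s + K * α)) * (1ℚ - τ * (s + K * α))) + ½ + ½ * (τ * τ) * (K * β)
      sum-of-squares = solve-∀ ℚ-ring

    𝔼-R≤R : ∀ K s → 𝔼 (λ σ → R K (s + φ σ)) ≤ℚ R (1ℚ + K) s
    𝔼-R≤R K s = begin
      𝔼 (λ σ → R K (s + φ σ))                          ≡⟨ 𝔼-cong (λ σ → expand τ K s α β (φ σ)) ⟩
      𝔼 (λ σ → R K s + a₁ * φ σ + a₂ * (φ σ * φ σ))    ≡⟨ 𝔼-quadratic (R K s) a₁ a₂ φ ⟩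
      R K s + a₁ * α + a₂ * β                          ≤⟨ ≤-byGap _ (step τ K s α β) (*-nonNeg (*-nonNeg 0≤½ (square-nonNeg τ)) (square-nonNeg α)) ⟩
      R (1ℚ + K) s                                     ∎
      where
      open ℚP.≤-Reasoning
      a₁ = τ * τ * (s + K * α) - τ
      a₂ = ½ * (τ * τ)
      expand : ∀ τ K s α β x →
        1ℚ - τ * ((s + x) + K * α) + ½ * (τ * τ) * (((s + x) + K * α) * ((s + x) + K * α) + K * β)
          ≡ (1ℚ - τ * (s + K * α) + ½ * (τ * τ) * ((s + K * α) * (s + K * α) + K * β))
            + (τ * τ * (s + K * α) - τ) * x + ½ * (τ * τ) * (x * x)
      expand = solve-∀ ℚ-ring
      step : ∀ τ K s α β →
        1ℚ - τ * (s + (1ℚ + K) * α) + ½ * (τ * τ) * ((s + (1ℚ + K) * α) * (s + (1ℚ + K) * α) + (1ℚ + K) * β)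
          - ((1ℚ - τ * (s + K * α) + ½ * (τ * τ) * ((s + K * α) * (s + K * α) + K * β))
             + (τ * τ * (s + K * α) - τ) * α + ½ * (τ * τ) * β)
          ≡ ½ * (τ * τ) * (α * α)
      step = solve-∀ ℚ-ring

    noCollision≤R : ∀ {t} → T ≤ t → ∀ k U → noCollision (k ℕ.+ t) U ≤ℚ R (ℕ→ℚ k) (Φ U)
    noCollision≤R {t} T≤t zero U = begin
      noCollision t U                              ≤⟨ noCollision≤[1-Φ]^ t U ⟩
      (1ℚ - Φ U) ^ t                               ≤⟨ ^-antimonoʳ-≤ (0≤1-Φ U) (sub-antimonoʳ-≤ 1ℚ (Φ-nonNeg U)) T≤t ⟩
      (1ℚ - Φ U) ^ T                               ≤⟨ [1-s]^n≤1-ns+½n²s² T (Φ-nonNeg U) (Φ≤1 U) ⟩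
      1ℚ - τ * Φ U + ½ * (τ * τ) * (Φ U * Φ U)     ≡⟨ no-instances τ (Φ U) α β ⟩
      R 0ℚ (Φ U)                                   ∎
      where
      open ℚP.≤-Reasoning
      no-instances : ∀ τ s α β →
        1ℚ - τ * s + ½ * (τ * τ) * (s * s) ≡ 1ℚ - τ * (s + 0ℚ * α) + ½ * (τ * τ) * ((s + 0ℚ * α) * (s + 0ℚ * α) + 0ℚ * β)
      no-instances = solve-∀ ℚ-ring
    noCollision≤R {t} T≤t (suc k) U = begin
      𝔼 (λ σ → if avoids (issued σ) U then noCollision (k ℕ.+ t) (U ∪ issued σ) else 0ℚ)
        ≤⟨ 𝔼-mono-≤ (λ σ → by-avoidance σ (avoids (issued σ) U) refl) ⟩
      𝔼 (λ σ → R (ℕ→ℚ k) (Φ U + φ σ))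
        ≤⟨ 𝔼-R≤R (ℕ→ℚ k) (Φ U) ⟩
      R (1ℚ + ℕ→ℚ k) (Φ U)
        ≡⟨ cong (λ K → R K (Φ U)) (ℕ→ℚ-suc k) ⟨
      R (ℕ→ℚ (suc k)) (Φ U)
        ∎
      where
      open ℚP.≤-Reasoning
      by-avoidance : ∀ σ b → avoids (issued σ) U ≡ b →
                     (if b then noCollision (k ℕ.+ t) (U ∪ issued σ) else 0ℚ) ≤ℚ R (ℕ→ℚ k) (Φ U + φ σ)
      by-avoidance σ true  S∩U≡∅ =
        ≤-trans (noCollision≤R T≤t k (U ∪ issued σ)) (≤-reflexive (cong (R (ℕ→ℚ k)) (Φ-∪ U σ S∩U≡∅)))
      by-avoidance σ false _     = R-nonNeg (Φ U + φ σ) (ℕ→ℚ-nonNeg k)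

  ½j²α≤collision : ∀ j {t} → j ≤ t → (∀ σ → ℕ→ℚ j * φ σ ≤ℚ ½) → ℕ→ℚ j * ℕ→ℚ j * α ≤ℚ ½ →
                   ½ * (ℕ→ℚ j * ℕ→ℚ j * α) ≤ℚ collision (j ℕ.+ t)
  ½j²α≤collision j {t} j≤t jφ≤½ j²α≤½ = begin
    ½ * (ι * ι * α)                 ≤⟨ ≤-byGap _ (gap ι α β) (ℚP.+-mono-≤
                                          (*-nonNeg 0≤½ (*-nonNeg (*-nonNeg (square-nonNeg ι) α-nonNeg) (p≤q⇒0≤q-p j²α≤½)))
                                          (*-nonNeg (*-nonNeg 0≤½ (square-nonNeg ι)) (p≤q⇒0≤q-p ιβ≤α½))) ⟩
    1ℚ - R ι 0ℚ                     ≡⟨ cong (λ s → 1ℚ - R ι s) Φ-∅ ⟨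
    1ℚ - R ι (Φ ∅)                  ≤⟨ sub-antimonoʳ-≤ 1ℚ (noCollision≤R j≤t j ∅) ⟩
    collision (j ℕ.+ t)             ∎
    where
    open ℚP.≤-Reasoning
    open SecondOrder j
    ι = ℕ→ℚ j
    ιβ≤α½ : ι * β ≤ℚ α * ½
    ιβ≤α½ = begin
      ι * β                         ≡⟨ *-distribˡ-𝔼 ι (λ σ → φ σ * φ σ) ⟩
      𝔼 (λ σ → ι * (φ σ * φ σ))     ≡⟨ 𝔼-cong (λ σ → rearrange ι (φ σ)) ⟩
      𝔼 (λ σ → φ σ * (ι * φ σ))     ≤⟨ 𝔼-mono-≤ (λ σ → *-monoˡ-≤-0≤ (φ-nonNeg σ) (jφ≤½ σ)) ⟩
      𝔼 (λ σ → φ σ * ½)             ≡⟨ *-distribʳ-𝔼 ½ φ ⟨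
      α * ½                         ∎
      where
      rearrange : ∀ ι x → ι * (x * x) ≡ x * (ι * x)
      rearrange = solve-∀ ℚ-ring
    gap : ∀ ι α β →
      1ℚ - (1ℚ - ι * (0ℚ + ι * α) + ½ * (ι * ι) * ((0ℚ + ι * α) * (0ℚ + ι * α) + ι * β)) - ½ * (ι * ι * α)
        ≡ ½ * ((ι * ι * α) * (½ - ι * ι * α)) + ½ * (ι * ι) * (α * ½ - ι * β)
    gap = solve-∀ ℚ-ring

  collision-dichotomy : ∀ {n N} → 2 ≤ n → N ℕ.+ N ≤ n →
                        (∀ j → j ≤ N → ℕ→ℚ j * ℕ→ℚ j * α ≤ℚ ¼ → ∀ σ → ℕ→ℚ j * φ σ ≤ℚ ½) →
                        1/32 ≤ℚ collision n ⊎ ½ * (ℕ→ℚ N * ℕ→ℚ N * α) ≤ℚ collision n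
  collision-dichotomy {n} {N} 2≤n N+N≤n jφ≤½ = from-crossing (crossing P (λ j → ℕ→ℚ j * ℕ→ℚ j * α ℚP.≤? ¼) P0 N)
    where
    P : ℕ → Set
    P j = ℕ→ℚ j * ℕ→ℚ j * α ≤ℚ ¼
    P0 : P 0
    P0 = ≤-trans (≤-reflexive (ℚP.*-zeroˡ α)) (ℚP.≤ᵇ⇒≤ _)
    ½j²α≤collisionₙ : ∀ j → j ≤ N → P j → ½ * (ℕ→ℚ j * ℕ→ℚ j * α) ≤ℚ collision n
    ½j²α≤collisionₙ j j≤N Pj = subst (λ k → ½ * (ℕ→ℚ j * ℕ→ℚ j * α) ≤ℚ collision k) (ℕP.m+[n∸m]≡n j≤n)
      (½j²α≤collision j j≤n∸j (jφ≤½ j j≤N Pj) (≤-trans Pj (ℚP.≤ᵇ⇒≤ _)))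
      where
      j≤n∸j : j ≤ n ℕ.∸ j
      j≤n∸j = ℕP.m+n≤o⇒m≤o∸n j (ℕP.≤-trans (ℕP.+-mono-≤ j≤N j≤N) N+N≤n)
      j≤n : j ≤ n
      j≤n = ℕP.≤-trans j≤n∸j (ℕP.m∸n≤m n j)
    α≤collisionₙ : α ≤ℚ collision n
    α≤collisionₙ = subst (λ k → α ≤ℚ collision k) (ℕP.m+[n∸m]≡n 2≤n) (α≤collision (n ℕ.∸ 2))
    from-crossing : P N ⊎ ∃[ j ] (j ℕ.< N × P j × ¬ P (suc j)) →
                    1/32 ≤ℚ collision n ⊎ ½ * (ℕ→ℚ N * ℕ→ℚ N * α) ≤ℚ collision n
    from-crossing (inj₁ PN)                   = inj₂ (½j²α≤collisionₙ N ℕP.≤-refl PN)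
    from-crossing (inj₂ (zero , _ , _ , ¬P1)) = inj₁ (begin
      1/32                        ≤⟨ ℚP.≤ᵇ⇒≤ _ ⟩
      ¼                           <⟨ ℚP.≰⇒> ¬P1 ⟩
      1ℚ * α                      ≡⟨ ℚP.*-identityˡ α ⟩
      α                           ≤⟨ α≤collisionₙ ⟩
      collision n                 ∎)
      where open ℚP.≤-Reasoning
    from-crossing (inj₂ (suc j , j<N , Pj , ¬Pj+1)) = inj₁ (begin
      1/32                                          ≤⟨ 1/32≤½ι²a (ℕ→ℚ-mono-≤ {1} {suc j} (s≤s z≤n)) α-nonNeg ¼≤[1+ι]²α ⟩
      ½ * (ℕ→ℚ (suc j) * ℕ→ℚ (suc j) * α)           ≤⟨ ½j²α≤collisionₙ (suc j) (ℕP.<⇒≤ j<N) Pj ⟩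
      collision n                                   ∎)
      where
      open ℚP.≤-Reasoning
      ¼≤[1+ι]²α : ¼ ≤ℚ (1ℚ + ℕ→ℚ (suc j)) * (1ℚ + ℕ→ℚ (suc j)) * α
      ¼≤[1+ι]²α = subst (λ ι → ¼ ≤ℚ ι * ι * α) (ℕ→ℚ-suc (suc j)) (ℚP.<⇒≤ (ℚP.≰⇒> ¬Pj+1))

-- Spread and concentrated algorithms

module Cases {m : ℕ} (A : Algorithm m) {n h : ℕ} (2≤n : 2 ≤ n) (1≤h : 1 ≤ h) (h≤m : h ≤ m) where
  open Expectation A
  open NoCollision A h

  N : ℕ
  N = ⌊ n /2⌋

  ν : ℚ
  ν = ℕ→ℚ N

  ∑-𝟙-∈ᵇ-issued-* : ∀ σ c → ∑[ x ∈ allFin m ] 𝟙 (x ∈ᵇ issued σ) * c ≡ ℕ→ℚ h * c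
  ∑-𝟙-∈ᵇ-issued-* σ c =
    trans (≡-sym (*-distribʳ-∑ c (allFin m) (λ x → 𝟙 (x ∈ᵇ issued σ)))) (cong (_* c) (∑-𝟙-∈ᵇ-outputs σ h≤m))

  ∑-hitProb : ∑[ x ∈ allFin m ] hitProb x ≡ ℕ→ℚ h
  ∑-hitProb = begin
    ∑[ x ∈ allFin m ] 𝔼 (λ σ → 𝟙 (x ∈ᵇ issued σ))    ≡⟨ ∑-𝔼-comm (allFin m) (λ x σ → 𝟙 (x ∈ᵇ issued σ)) ⟩
    𝔼 (λ σ → ∑[ x ∈ allFin m ] 𝟙 (x ∈ᵇ issued σ))    ≡⟨ 𝔼-cong (λ σ → ∑-𝟙-∈ᵇ-outputs σ h≤m) ⟩
    𝔼 (λ _ → ℕ→ℚ h)                                  ≡⟨ 𝔼-const (ℕ→ℚ h) ⟩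
    ℕ→ℚ h                                            ∎
    where open ≡-Reasoning

  spread : (∀ x → ν * hitProb x ≤ℚ ½) → 1/32 ≤ℚ collision n ⊎ ½ * (ν * ν * ℕ→ℚ h) ≤ℚ collision n * ℕ→ℚ m
  spread νq≤½ = Sum.map₂ rescale (collision-dichotomy 2≤n (⌊n/2⌋+⌊n/2⌋≤n n) jφ≤½)
    where
    v : ℚ
    v = proj₁ (ℕ→ℚ-reciprocal 1≤h)
    0≤v : 0ℚ ≤ℚ v
    0≤v = proj₁ (proj₂ (ℕ→ℚ-reciprocal 1≤h))
    v*h≡1 : v * ℕ→ℚ h ≡ 1ℚ
    v*h≡1 = proj₂ (proj₂ (ℕ→ℚ-reciprocal 1≤h))
    load≤1 : ∀ σ → ∑[ x ∈ allFin m ] 𝟙 (x ∈ᵇ outputs σ h) * v ≤ℚ 1ℚ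
    load≤1 σ = ≤-reflexive (trans (∑-𝟙-∈ᵇ-issued-* σ v) (trans (ℚP.*-comm (ℕ→ℚ h) v) v*h≡1))
    open Potential A h (λ _ → v) (λ _ → 0≤v) load≤1
    jφ≤½ : ∀ j → j ≤ N → ℕ→ℚ j * ℕ→ℚ j * α ≤ℚ ¼ → ∀ σ → ℕ→ℚ j * φ σ ≤ℚ ½
    jφ≤½ j j≤N _ σ = begin
      ι * φ σ                                                       ≡⟨ *-distribˡ-∑ ι (allFin m) (λ x → 𝟙 (x ∈ᵇ issued σ) * charge x) ⟩
      ∑[ x ∈ allFin m ] ι * (𝟙 (x ∈ᵇ issued σ) * (hitProb x * v))   ≡⟨ ∑-cong (allFin m) (λ x → rearrange ι (𝟙 (x ∈ᵇ issued σ)) (hitProb x) v) ⟩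
      ∑[ x ∈ allFin m ] 𝟙 (x ∈ᵇ issued σ) * (ι * hitProb x * v)
        ≤⟨ ∑-mono-≤ (allFin m) (λ x → *-monoˡ-≤-0≤ (𝟙-nonNeg (x ∈ᵇ issued σ)) (*-monoʳ-≤-0≤ 0≤v (ιq≤½ x))) ⟩
      ∑[ x ∈ allFin m ] 𝟙 (x ∈ᵇ issued σ) * (½ * v)                 ≡⟨ ∑-𝟙-∈ᵇ-issued-* σ (½ * v) ⟩
      ℕ→ℚ h * (½ * v)                                               ≡⟨ halve (ℕ→ℚ h) v ⟩
      ½ * (v * ℕ→ℚ h)                                               ≡⟨ cong (½ *_) v*h≡1 ⟩
      ½ * 1ℚ                                                        ≡⟨ ℚP.*-identityʳ ½ ⟩
      ½                                                             ∎
      where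
      open ℚP.≤-Reasoning
      ι = ℕ→ℚ j
      ιq≤½ : ∀ x → ι * hitProb x ≤ℚ ½
      ιq≤½ x = ≤-trans (*-monoʳ-≤-0≤ (hitProb-nonNeg x) (ℕ→ℚ-mono-≤ j≤N)) (νq≤½ x)
      rearrange : ∀ ι b q v → ι * (b * (q * v)) ≡ b * (ι * q * v)
      rearrange = solve-∀ ℚ-ring
      halve : ∀ η v → η * (½ * v) ≡ ½ * (v * η)
      halve = solve-∀ ℚ-ring
    h≤α*m : ℕ→ℚ h ≤ℚ α * ℕ→ℚ m
    h≤α*m = begin
      ℕ→ℚ h                                                       ≡⟨ ℚP.*-identityˡ (ℕ→ℚ h) ⟨
      1ℚ * ℕ→ℚ h                                                  ≡⟨ cong (_* ℕ→ℚ h) v*h≡1 ⟨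
      v * ℕ→ℚ h * ℕ→ℚ h                                           ≡⟨ ℚP.*-assoc v (ℕ→ℚ h) (ℕ→ℚ h) ⟩
      v * (ℕ→ℚ h * ℕ→ℚ h)                                         ≡⟨ cong (λ η → v * (η * η)) ∑-hitProb ⟨
      v * (∑ (allFin m) hitProb * ∑ (allFin m) hitProb)           ≤⟨ *-monoˡ-≤-0≤ 0≤v (cauchy-schwarz (allFin m) hitProb) ⟩
      v * (ℕ→ℚ (length (allFin m)) * (∑[ x ∈ allFin m ] hitProb x * hitProb x))
                                                                  ≡⟨ cong (λ k → v * (ℕ→ℚ k * (∑[ x ∈ allFin m ] hitProb x * hitProb x))) (LP.length-tabulate {n = m} id) ⟩
      v * (ℕ→ℚ m * (∑[ x ∈ allFin m ] hitProb x * hitProb x))     ≡⟨ rearrange v (ℕ→ℚ m) _ ⟩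
      ((∑[ x ∈ allFin m ] hitProb x * hitProb x) * v) * ℕ→ℚ m     ≡⟨ cong (_* ℕ→ℚ m) (*-distribʳ-∑ v (allFin m) (λ x → hitProb x * hitProb x)) ⟩
      (∑[ x ∈ allFin m ] hitProb x * hitProb x * v) * ℕ→ℚ m       ≡⟨ cong (_* ℕ→ℚ m) (∑-cong (allFin m) (λ x → ℚP.*-assoc (hitProb x) (hitProb x) v)) ⟩
      (∑[ x ∈ allFin m ] hitProb x * charge x) * ℕ→ℚ m            ≡⟨ cong (_* ℕ→ℚ m) α≡∑hitProb*charge ⟨
      α * ℕ→ℚ m                                                   ∎
      where
      open ℚP.≤-Reasoning
      rearrange : ∀ v μ s → v * (μ * s) ≡ s * v * μ
      rearrange = solve-∀ ℚ-ring
    rescale : ½ * (ν * ν * α) ≤ℚ collision n → ½ * (ν * ν * ℕ→ℚ h) ≤ℚ collision n * ℕ→ℚ m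
    rescale ½ν²α≤collision = begin
      ½ * (ν * ν * ℕ→ℚ h)           ≤⟨ *-monoˡ-≤-0≤ 0≤½ (*-monoˡ-≤-0≤ (square-nonNeg ν) h≤α*m) ⟩
      ½ * (ν * ν * (α * ℕ→ℚ m))     ≡⟨ reassociate ½ (ν * ν) α (ℕ→ℚ m) ⟩
      ½ * (ν * ν * α) * ℕ→ℚ m       ≤⟨ *-monoʳ-≤-0≤ (ℕ→ℚ-nonNeg m) ½ν²α≤collision ⟩
      collision n * ℕ→ℚ m           ∎
      where
      open ℚP.≤-Reasoning
      reassociate : ∀ a b c d → a * (b * (c * d)) ≡ a * (b * c) * d
      reassociate = solve-∀ ℚ-ring

  concentrated : ∀ x₀ → ½ < ν * hitProb x₀ → 1/32 ≤ℚ collision n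
  concentrated x₀ ½<νq₀ = Sum.[ id , ≤-trans 1/32≤½ν²α ] (collision-dichotomy 2≤n (⌊n/2⌋+⌊n/2⌋≤n n) jφ≤½)
    where
    q₀ = hitProb x₀
    δ : Fin m → ℚ
    δ x = 𝟙 ⌊ x ≟ x₀ ⌋
    load≤1 : ∀ σ → ∑[ x ∈ allFin m ] 𝟙 (x ∈ᵇ outputs σ h) * δ x ≤ℚ 1ℚ
    load≤1 σ = ≤-trans (≤-reflexive (∑-δ (λ x → 𝟙 (x ∈ᵇ issued σ)) x₀)) (𝟙-≤1 (x₀ ∈ᵇ issued σ))
    open Potential A h δ (λ x → 𝟙-nonNeg ⌊ x ≟ x₀ ⌋) load≤1
    φ≡ : ∀ σ → φ σ ≡ 𝟙 (x₀ ∈ᵇ issued σ) * q₀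
    φ≡ σ = trans (∑-cong (allFin m) (λ x → ≡-sym (ℚP.*-assoc (𝟙 (x ∈ᵇ issued σ)) (hitProb x) (δ x))))
                 (∑-δ (λ x → 𝟙 (x ∈ᵇ issued σ) * hitProb x) x₀)
    α≡q₀² : α ≡ q₀ * q₀
    α≡q₀² = trans (𝔼-cong φ≡) (≡-sym (*-distribʳ-𝔼 q₀ (λ σ → 𝟙 (x₀ ∈ᵇ issued σ))))
    square-of-product : ∀ ι → ι * ι * α ≡ (ι * q₀) * (ι * q₀)
    square-of-product ι = trans (cong (ι * ι *_) α≡q₀²) (rearrange ι q₀)
      where
      rearrange : ∀ ι q → ι * ι * (q * q) ≡ (ι * q) * (ι * q)
      rearrange = solve-∀ ℚ-ring
    jφ≤½ : ∀ j → j ≤ N → ℕ→ℚ j * ℕ→ℚ j * α ≤ℚ ¼ → ∀ σ → ℕ→ℚ j * φ σ ≤ℚ ½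
    jφ≤½ j _ j²α≤¼ σ = begin
      ι * φ σ                             ≡⟨ cong (ι *_) (φ≡ σ) ⟩
      ι * (𝟙 (x₀ ∈ᵇ issued σ) * q₀)       ≡⟨ swap ι (𝟙 (x₀ ∈ᵇ issued σ)) q₀ ⟩
      𝟙 (x₀ ∈ᵇ issued σ) * (ι * q₀)       ≤⟨ *-monoʳ-≤-0≤ (*-nonNeg (ℕ→ℚ-nonNeg j) (hitProb-nonNeg x₀)) (𝟙-≤1 (x₀ ∈ᵇ issued σ)) ⟩
      1ℚ * (ι * q₀)                       ≡⟨ ℚP.*-identityˡ (ι * q₀) ⟩
      ι * q₀                              ≤⟨ p*p≤¼⇒p≤½ (subst (_≤ℚ ¼) (square-of-product ι) j²α≤¼) ⟩
      ½                                   ∎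
      where
      open ℚP.≤-Reasoning
      ι = ℕ→ℚ j
      swap : ∀ ι b q → ι * (b * q) ≡ b * (ι * q)
      swap = solve-∀ ℚ-ring
    1/32≤½ν²α : 1/32 ≤ℚ ½ * (ν * ν * α)
    1/32≤½ν²α = begin
      1/32                          ≤⟨ ℚP.≤ᵇ⇒≤ _ ⟩
      ½ * ¼                         ≤⟨ *-monoˡ-≤-0≤ 0≤½ (ℚP.<⇒≤ (½<p⇒¼<p*p ½<νq₀)) ⟩
      ½ * ((ν * q₀) * (ν * q₀))     ≡⟨ cong (½ *_) (square-of-product ν) ⟨
      ½ * (ν * ν * α)               ∎
      where open ℚP.≤-Reasoning

  collision-bound : 1/32 ≤ℚ collision n ⊎ ½ * (ν * ν * ℕ→ℚ h) ≤ℚ collision n * ℕ→ℚ m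
  collision-bound with Data.Fin.Properties.any? (λ x → ½ ℚP.<? ν * hitProb x)
  ... | yes (x₀ , ½<νq₀) = inj₁ (concentrated x₀ ½<νq₀)
  ... | no  ¬concentrated = spread (λ x → ℚP.≮⇒≥ (λ ½<νq → ¬concentrated (x , ½<νq)))

1/64 : ℚ
1/64 = ℤ.+ 1 / 64

1/64*n²h≤½*N²h : ∀ {n} N h → n ≤ N ℕ.+ (N ℕ.+ N) →
                 1/64 * ℕ→ℚ (n ℕ.* n ℕ.* h) ≤ℚ ½ * (ℕ→ℚ N * ℕ→ℚ N * ℕ→ℚ h)
1/64*n²h≤½*N²h {n} N h n≤3N = begin
  1/64 * ℕ→ℚ (n ℕ.* n ℕ.* h)       ≡⟨ cong (1/64 *_) (trans (ℕ→ℚ-* (n ℕ.* n) h) (cong (_* η) (ℕ→ℚ-* n n))) ⟩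
  1/64 * (ι * ι * η)               ≤⟨ ≤-byGap _ (gap ι ν η) (ℚP.+-mono-≤
                                        (*-nonNeg {1/64} (ℚP.≤ᵇ⇒≤ _) (*-nonNeg (*-nonNeg (p≤q⇒0≤q-p ι≤3ν) 0≤3ν+ι) (ℕ→ℚ-nonNeg h)))
                                        (*-nonNeg {ℤ.+ 23 / 64} (ℚP.≤ᵇ⇒≤ _) (*-nonNeg (square-nonNeg ν) (ℕ→ℚ-nonNeg h)))) ⟩
  ½ * (ν * ν * η)                  ∎
  where
  open ℚP.≤-Reasoning
  ι = ℕ→ℚ n
  ν = ℕ→ℚ N
  η = ℕ→ℚ h
  ι≤3ν : ι ≤ℚ ν + (ν + ν)
  ι≤3ν = ≤-trans (ℕ→ℚ-mono-≤ n≤3N) (≤-reflexive (trans (ℕ→ℚ-+ N (N ℕ.+ N)) (cong (ν +_) (ℕ→ℚ-+ N N))))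
  0≤3ν+ι : 0ℚ ≤ℚ ν + (ν + ν) + ι
  0≤3ν+ι = ℚP.+-mono-≤ (ℚP.+-mono-≤ (ℕ→ℚ-nonNeg N) (ℚP.+-mono-≤ (ℕ→ℚ-nonNeg N) (ℕ→ℚ-nonNeg N))) (ℕ→ℚ-nonNeg n)
  gap : ∀ ι ν η → ½ * (ν * ν * η) - 1/64 * (ι * ι * η)
                  ≡ 1/64 * ((ν + (ν + ν) - ι) * (ν + (ν + ν) + ι) * η) + ℤ.+ 23 / 64 * (ν * ν * η)
  gap = solve-∀ ℚ-ring

dichotomy⇒min-bound : ∀ {p M n h} N → 0ℚ ≤ℚ M → n ≤ N ℕ.+ (N ℕ.+ N) →
                      1/32 ≤ℚ p ⊎ ½ * (ℕ→ℚ N * ℕ→ℚ N * ℕ→ℚ h) ≤ℚ p * M →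
                      1/64 * (M ⊓ ℕ→ℚ (n ℕ.* n ℕ.* h)) ≤ℚ p * M
dichotomy⇒min-bound {p} {M} {n} {h} N 0≤M _ (inj₁ 1/32≤p) = begin
  1/64 * (M ⊓ ℕ→ℚ (n ℕ.* n ℕ.* h))    ≤⟨ *-monoˡ-≤-0≤ {1/64} (ℚP.≤ᵇ⇒≤ _) (ℚP.p⊓q≤p M _) ⟩
  1/64 * M                            ≤⟨ *-monoʳ-≤-0≤ {M} {1/64} {1/32} 0≤M (ℚP.≤ᵇ⇒≤ _) ⟩
  1/32 * M                            ≤⟨ *-monoʳ-≤-0≤ 0≤M 1/32≤p ⟩
  p * M                               ∎
  where open ℚP.≤-Reasoning
dichotomy⇒min-bound {p} {M} {n} {h} N 0≤M n≤3N (inj₂ ½N²h≤pM) = begin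
  1/64 * (M ⊓ ℕ→ℚ (n ℕ.* n ℕ.* h))    ≤⟨ *-monoˡ-≤-0≤ {1/64} (ℚP.≤ᵇ⇒≤ _) (ℚP.p⊓q≤q M _) ⟩
  1/64 * ℕ→ℚ (n ℕ.* n ℕ.* h)          ≤⟨ 1/64*n²h≤½*N²h N h n≤3N ⟩
  ½ * (ℕ→ℚ N * ℕ→ℚ N * ℕ→ℚ h)        ≤⟨ ½N²h≤pM ⟩
  p * M                               ∎
  where open ℚP.≤-Reasoning

corollary5p3 : Σ ℚ (λ c → (0ℚ < c) × ((m n h : ℕ) → 2 ≤ n → 1 ≤ h → h ≤ m → (A : Algorithm m) →
                 c * (ℕ→ℚ m ⊓ ℕ→ℚ (n Data.Nat.* n Data.Nat.* h)) ≤ℚ collisionProb A (replicate n h) * ℕ→ℚ m))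
corollary5p3 = 1/64 , ℚP.positive⁻¹ 1/64 , λ m n h 2≤n 1≤h h≤m A →
  subst (λ p → 1/64 * (ℕ→ℚ m ⊓ ℕ→ℚ (n ℕ.* n ℕ.* h)) ≤ℚ p * ℕ→ℚ m)
        (≡-sym (NoCollision.collisionProb≡collision A h n))
        (dichotomy⇒min-bound ⌊ n /2⌋ (ℕ→ℚ-nonNeg m) (n≤3⌊n/2⌋ 2≤n) (Cases.collision-bound A 2≤n 1≤h h≤m))
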